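{- Let $\mathcal{I}_2$ be a WMSO-interpretation such that $\mathcal{I}_2(\Delta_2)$ is isomorphic to $\Delta_1=(\mathbb{N},\mathit{succ})$, and let $f_2:\mathbb{N}\to\{0,1\}^*$ be the injection witnessing this isomorphism (an isomorphism from $(\mathbb{N},\mathit{succ})$ onto $\mathcal{I}_2(\Delta_2)$, whose universe is a subset of $\{0,1\}^*$). Then there exist natural numbers $m,n>0$ and words $u,v,w_0,\dots,w_{n-1}\in\{0,1\}^*$ such that for all $k\ge 0$ and all $p\in\{0,\dots,n-1\}$, $f_2(m+kn+p)=uv^kw_p$.
   Context: $\Delta_1$ is the unlabeled tree with domain $0^*$, identified with $(\mathbb{N},\mathit{succ})$; $\Delta_2$ is the unlabeled tree with domain $\{0,1\}^*$ with binary relations $S_i(u,v)\iff v=ui$ ($i=0,1$). WMSO is MSO with set variables ranging over finite sets. A WMSO-interpretation $(\delta(x),\Phi(x,y))$ consists of WMSO formulas with first-order free variables; its image of $\Delta_2$ has universe $\{u:\Delta_2\models\delta(u)\}$ and binary relation $\{(u,v):\Delta_2\models\Phi(u,v)\}$. -}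

module Defs where

open import Data.Nat using (ℕ; zero; suc; _+_; _*_; _<_)
open import Data.Fin using (Fin; toℕ; zero; suc)
open import Data.Bool using (Bool)
open import Data.List using (List; []; _∷_; _++_; [_]; concat; replicate)
open import Data.List.Membership.Propositional using (_∈_)
open import Data.Product using (Σ; _×_; _,_; ∃)
open import Data.Sum using (_⊎_)
open import Relation.Nullary using (¬_)
open import Relation.Binary.PropositionalEquality using (_≡_)
open import Function.Bundles using (_⇔_)

-- Nodes of the full binary tree Δ₂ : words over {0,1} (false = 0, true = 1).
Word : Set
Word = List Bool

-- Finite sets of nodes (the range of WMSO set variables), given by a
-- finite list of their elements.
FinSet : Set
FinSet = List Word

-- WMSO formulas over the signature of Δ₂ (S₀, S₁), with de Bruijn
-- indices: i first-order variables and j (weak) set variables in scope.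
data WMSO (i j : ℕ) : Set where
  S     : Bool → Fin i → Fin i → WMSO i j      -- S_b(x,y) : y = x b
  eq    : Fin i → Fin i → WMSO i j
  mem   : Fin i → Fin j → WMSO i j
  neg   : WMSO i j → WMSO i j
  and   : WMSO i j → WMSO i j → WMSO i j
  ex1   : WMSO (suc i) j → WMSO i j
  ex2   : WMSO i (suc j) → WMSO i j

extend : {A : Set} {n : ℕ} → A → (Fin n → A) → Fin (suc n) → A
extend a ρ zero    = a
extend a ρ (suc k) = ρ k

Sat : {i j : ℕ} → WMSO i j → (Fin i → Word) → (Fin j → FinSet) → Set
Sat (S b x y) ρ σ = ρ y ≡ ρ x ++ [ b ]
Sat (eq x y)  ρ σ = ρ x ≡ ρ y
Sat (mem x X) ρ σ = ρ x ∈ σ X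
Sat (neg φ)   ρ σ = ¬ Sat φ ρ σ
Sat (and φ ψ) ρ σ = Sat φ ρ σ × Sat ψ ρ σ
Sat (ex1 φ)   ρ σ = Σ Word λ u → Sat φ (extend u ρ) σ
Sat (ex2 φ)   ρ σ = Σ FinSet λ X → Sat φ ρ (extend X σ)

noSets : Fin 0 → FinSet
noSets ()

one : Word → Fin 1 → Word
one u _ = u

two : Word → Word → Fin 2 → Word
two u v zero    = u
two u v (suc _) = v

record Interpretation : Set where
  field
    δ : WMSO 1 0
    Φ : WMSO 2 0

Dom : Interpretation → Word → Set
Dom I u = Sat (Interpretation.δ I) (one u) noSets

Rel : Interpretation → Word → Word → Set
Rel I u v = Sat (Interpretation.Φ I) (two u v) noSets

IsIsoFromΔ₁ : Interpretation → (ℕ → Word) → Set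
IsIsoFromΔ₁ I f =
  ((a b : ℕ) → f a ≡ f b → a ≡ b)
  × ((a : ℕ) → Dom I (f a))
  × ((u : Word) → Dom I u → ∃ λ a → f a ≡ u)
  × ((a b : ℕ) → Rel I (f a) (f b) ⇔ (b ≡ suc a))

_^^_ : Word → ℕ → Word
v ^^ k = concat (replicate k v)

{-# OPTIONS --safe #-}
-- WMSO formulas over Δ₂ compile to bottom-up tree automata, so I(Δ₂) is governed by finitely
-- many automaton states.  First, if f (a + 1) = w s with s
-- long, then w is a prefix of f a: otherwise s pumps down to a shorter s′ for which w s′ is a
-- second successor of f a.  Since the words f a eventually get long, they eventually share
-- every prefix g of fixed length.  Second, g has prefixes x and x y (y ≠ []) acting alike on
-- states, and such prefixes are interchangeable in front of any suffix.  So if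
-- f (a₀ + k) = x T k for all k, then x y T k = f (h₀ + k) for all k, lengths force h₀ > a₀,
-- and with n = h₀ − a₀ we get T (n + k) = y T k.
module Submission where

open import Defs
open import Data.Bool using (Bool; true; false; not; if_then_else_)
import Data.Bool.Properties as Bool
open import Data.Empty using (⊥-elim)
open import Data.Maybe as Maybe using (Maybe; just; nothing; _>>=_; maybe′)
open import Data.Maybe.Properties using (just-injective)
open import Data.Fin as Fin using (Fin; zero; suc; toℕ)
import Data.Fin.Properties as Fin
open import Data.Fin.Subset as Subset using (Subset; _∪_; _⊆_)
  renaming (_∈_ to _∈ˢ_; ⊥ to ∅)
import Data.Fin.Subset.Properties as Subset
open import Data.List as List using (List; []; _∷_; _++_; length; mapMaybe)
import Data.List.Properties as List
open import Data.List.Membership.Propositional using (_∈_; lose)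
open import Data.List.Membership.DecPropositional (List.≡-dec Bool._≟_) using (_∈?_)
open import Data.List.Membership.Propositional.Properties
  using (∈-cartesianProduct⁺; ∈-cartesianProductWith⁺; ∈-++⁻; ∈-++⁺ˡ; ∈-++⁺ʳ; ∈-map⁻; ∈-map⁺)
open import Data.List.Relation.Unary.Any as Any using (here; there; satisfied)
import Data.List.Relation.Unary.Any.Properties as Any
open import Data.Nat as ℕ using (ℕ; zero; suc; _+_; _*_; _∸_; _≤_; _<_; z≤n; s≤s; _⊔_)
import Data.Nat.Properties as ℕ
open import Data.Product using (Σ; ∃; ∃₂; _×_; _,_; proj₁; proj₂; map₂)
open import Data.Sum using (_⊎_; inj₁; inj₂)
open import Data.Vec as Vec using (Vec; []; _∷_)
import Data.Vec.Properties as Vec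
open import Function using (_∘_)
open import Function.Bundles using (_⇔_; mk⇔; Equivalence)
import Function.Properties.Equivalence as ⇔
open import Function.Related.TypeIsomorphisms using (¬-cong-⇔)
open import Data.Product.Function.NonDependent.Propositional using (_×-⇔_)
open import Relation.Binary.Definitions using (DecidableEquality)
open import Relation.Binary.PropositionalEquality
open import Relation.Nullary using (Dec; yes; no; does; ¬_; ¬?; _×-dec_; _⊎-dec_; map′)
open import Relation.Nullary.Decidable using (dec-true; dec-false)
open import Relation.Unary using (Pred; Decidable)
open import Level using (0ℓ)

record Finite : Set₁ where
  field
    Carrier  : Set
    elements : List Carrier
    complete : ∀ x → x ∈ elements

  size : ℕ
  size = length elements

  index : Carrier → Fin size
  index x = Any.index (complete x)

  decode : Fin size → Carrier
  decode = List.lookup elements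

  decode-index : ∀ x → decode (index x) ≡ x
  decode-index x = sym (Any.lookup-index (complete x))

  index-injective : ∀ {x y} → index x ≡ index y → x ≡ y
  index-injective {x} {y} same =
    trans (sym (decode-index x)) (trans (cong decode same) (decode-index y))

  _≟_ : DecidableEquality Carrier
  x ≟ y = map′ index-injective (cong index) (index x Fin.≟ index y)

  any? : {P : Pred Carrier 0ℓ} → Decidable P → Dec (∃ P)
  any? P? = map′ satisfied (λ (x , px) → lose (complete x) px) (Any.any? P? elements)

  pigeonhole : (g : Fin (suc size) → Carrier) → ∃₂ λ i j → i Fin.< j × g i ≡ g j
  pigeonhole g with i , j , i<j , same ← Fin.pigeonhole (ℕ.n<1+n size) (index ∘ g)
    = i , j , i<j , index-injective same

  _∈ᶠ_ : Carrier → Subset size → Set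
  x ∈ᶠ p = index x ∈ˢ p

  subsetOf : {P : Pred Carrier 0ℓ} → Decidable P → Subset size
  subsetOf P? = Vec.tabulate (does ∘ P? ∘ decode)

  _∈ᶠ?_ : ∀ x p → Dec (x ∈ᶠ p)
  x ∈ᶠ? p = index x Subset.∈? p

  tabulate : {B : Set} → (Carrier → B) → Vec B size
  tabulate φ = Vec.tabulate (φ ∘ decode)

  tabulate-injective : ∀ {B : Set} {φ ψ : Carrier → B} → tabulate φ ≡ tabulate ψ → ∀ x → φ x ≡ ψ x
  tabulate-injective {φ = φ} {ψ} same x = begin
    φ x                                ≡⟨ cong φ (decode-index x) ⟨
    φ (decode (index x))               ≡⟨ Vec.lookup∘tabulate (φ ∘ decode) (index x) ⟨
    Vec.lookup (tabulate φ) (index x)  ≡⟨ cong (λ t → Vec.lookup t (index x)) same ⟩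
    Vec.lookup (tabulate ψ) (index x)  ≡⟨ Vec.lookup∘tabulate (ψ ∘ decode) (index x) ⟩
    ψ (decode (index x))               ≡⟨ cong ψ (decode-index x) ⟩
    ψ x                                ∎
    where open ≡-Reasoning

  ∈ˢ-subsetOf : {P : Pred Carrier 0ℓ} (P? : Decidable P) {k : Fin size} → k ∈ˢ subsetOf P? ⇔ P (decode k)
  ∈ˢ-subsetOf {P} P? {k} = mk⇔
    (λ k∈ → does-true (trans (sym (Vec.lookup∘tabulate _ k)) (Vec.[]=⇒lookup k∈)))
    (λ pk → Vec.lookup⇒[]= _ _ (trans (Vec.lookup∘tabulate _ k) (dec-true (P? (decode k)) pk)))
    where
    does-true : does (P? (decode k)) ≡ true → P (decode k)
    does-true with P? (decode k)
    ... | yes pk = λ _ → pk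

  ∈-subsetOf : {P : Pred Carrier 0ℓ} (P? : Decidable P) {x : Carrier} → x ∈ᶠ subsetOf P? ⇔ P x
  ∈-subsetOf {P} P? {x} = subst (λ y → x ∈ᶠ subsetOf P? ⇔ P y) (decode-index x) (∈ˢ-subsetOf P?)

open Finite using (Carrier; size; index; decode; decode-index)

finite-Bool : Finite
finite-Bool = record
  { Carrier = Bool ; elements = false ∷ true ∷ [] ; complete = λ { false → here refl ; true → there (here refl) } }

_×ᶠ_ : Finite → Finite → Finite
A ×ᶠ B = record
  { Carrier  = Carrier A × Carrier B
  ; elements = List.cartesianProduct (Finite.elements A) (Finite.elements B)
  ; complete = λ (a , b) → ∈-cartesianProduct⁺ (Finite.complete A a) (Finite.complete B b)
  }

Vecᶠ : Finite → ℕ → Finite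
Vecᶠ A n = record { Carrier = Vec (Carrier A) n ; elements = vectors n ; complete = vectors-complete }
  where
  vectors : ∀ n → List (Vec (Carrier A) n)
  vectors zero    = [] ∷ []
  vectors (suc n) = List.cartesianProductWith _∷_ (Finite.elements A) (vectors n)

  vectors-complete : ∀ {n} (xs : Vec (Carrier A) n) → xs ∈ vectors n
  vectors-complete []       = here refl
  vectors-complete (x ∷ xs) = ∈-cartesianProductWith⁺ _∷_ (Finite.complete A x) (vectors-complete xs)

Subsetᶠ : Finite → Finite
Subsetᶠ A = Vecᶠ finite-Bool (size A)

module Closure {n : ℕ} (F : Subset n → Subset n) (F-mono : ∀ {p q} → p ⊆ q → F p ⊆ F q)
               (base : Subset n) (base⊆F : base ⊆ F base) where

  iterate : ℕ → Subset n
  iterate zero    = base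
  iterate (suc k) = iterate k ∪ F (iterate k)

  iterate-grows : ∀ k → iterate k ⊆ iterate (suc k)
  iterate-grows k = Subset.p⊆p∪q (F (iterate k))

  iterate⊆F : ∀ k → iterate k ⊆ F (iterate k)
  iterate⊆F zero    = base⊆F
  iterate⊆F (suc k) x∈ with Subset.x∈p∪q⁻ (iterate k) (F (iterate k)) x∈
  ... | inj₁ x∈iterate = F-mono (iterate-grows k) (iterate⊆F k x∈iterate)
  ... | inj₂ x∈F       = F-mono (iterate-grows k) x∈F

  constant-after : ∀ {m} → iterate (suc m) ⊆ iterate m → ∀ d → iterate (d + m) ≡ iterate m
  constant-after stalls zero    = refl
  constant-after {m} stalls (suc d) =
    trans (cong (λ p → p ∪ F p) (constant-after stalls d)) (Subset.⊆-antisym stalls (iterate-grows m))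

  stalls-or-grows : ∀ k → (∃ λ m → m < k × iterate (suc m) ⊆ iterate m) ⊎ k ≤ Subset.∣ iterate k ∣
  stalls-or-grows zero = inj₂ z≤n
  stalls-or-grows (suc k) with stalls-or-grows k
  ... | inj₁ (m , m<k , stalls) = inj₁ (m , ℕ.m≤n⇒m≤1+n m<k , stalls)
  ... | inj₂ k≤∣iterate∣ with iterate k Subset.⊂? iterate (suc k)
  ...   | yes grows = inj₂ (ℕ.≤-<-trans k≤∣iterate∣ (Subset.p⊂q⇒∣p∣<∣q∣ grows))
  ...   | no ¬grows = inj₁ (k , ℕ.n<1+n k , stalls)
    where
    stalls : iterate (suc k) ⊆ iterate k
    stalls {x} x∈ with x Subset.∈? iterate k
    ... | yes x∈iterate = x∈iterate
    ... | no  x∉iterate = ⊥-elim (¬grows (iterate-grows k , x , x∈ , x∉iterate))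

  closure : Subset n
  closure = iterate n

  iterate-suc-n : iterate (suc n) ≡ closure
  iterate-suc-n with stalls-or-grows (suc n)
  ... | inj₂ too-big = ⊥-elim (ℕ.<⇒≱ (s≤s (Subset.∣p∣≤n (iterate (suc n)))) too-big)
  ... | inj₁ (m , m<1+n , stalls) = trans (at (suc n) (ℕ.<⇒≤ m<1+n)) (sym (at n (ℕ.≤-pred m<1+n)))
    where
    at : ∀ k → m ≤ k → iterate k ≡ iterate m
    at k m≤k = subst (λ l → iterate l ≡ iterate m) (ℕ.m∸n+n≡m m≤k) (constant-after stalls (k ∸ m))

  F-closure : F closure ≡ closure
  F-closure = Subset.⊆-antisym
    (subst (F closure ⊆_) iterate-suc-n (Subset.q⊆p∪q closure (F closure)))
    (iterate⊆F n)

  base⊆closure : base ⊆ closure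
  base⊆closure = go n
    where
    go : ∀ k → base ⊆ iterate k
    go zero    = λ x∈ → x∈
    go (suc k) = iterate-grows k ∘ go k

  closure-induction : (P : Pred (Fin n) 0ℓ) → (∀ {x} → x ∈ˢ base → P x) →
                      (∀ p → (∀ {x} → x ∈ˢ p → P x) → ∀ {x} → x ∈ˢ F p → P x) →
                      ∀ {x} → x ∈ˢ closure → P x
  closure-induction P P-base P-step = go n
    where
    go : ∀ k {x} → x ∈ˢ iterate k → P x
    go zero    = P-base
    go (suc k) x∈ with Subset.x∈p∪q⁻ (iterate k) (F (iterate k)) x∈
    ... | inj₁ x∈iterate = go k x∈iterate
    ... | inj₂ x∈F       = P-step (iterate k) (go k) x∈F

-- An assignment of i first-order and j set variables, seen from a node of Δ₂: positions are
-- words relative to the node, and `nothing` marks a first-order variable outside its subtree.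
Valuation : ℕ → ℕ → Set
Valuation i j = Vec (Maybe Word) i × Vec FinSet j

Label : ℕ → ℕ → Set
Label i j = Vec Bool i × Vec Bool j

blank : ∀ {i j} → Valuation i j
blank = Vec.replicate _ nothing , Vec.replicate _ []

blankLabel : ∀ {i j} → Label i j
blankLabel = Vec.replicate _ false , Vec.replicate _ false

atRoot : Maybe Word → Bool
atRoot (just []) = true
atRoot _         = false

containsRoot : FinSet → Bool
containsRoot X = does ([] ∈? X)

strip : Bool → Word → Maybe Word
strip false (false ∷ w) = just w
strip true  (true ∷ w)  = just w
strip _     _           = nothing

label : ∀ {i j} → Valuation i j → Label i j
label (ρ , σ) = Vec.map atRoot ρ , Vec.map containsRoot σ

derive : ∀ {i j} → Bool → Valuation i j → Valuation i j
derive b (ρ , σ) = Vec.map (_>>= strip b) ρ , Vec.map (mapMaybe (strip b)) σ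

label-blank : ∀ {i j} → label (blank {i} {j}) ≡ blankLabel
label-blank = cong₂ _,_ (Vec.map-replicate atRoot nothing _) (Vec.map-replicate containsRoot [] _)

derive-blank : ∀ {i j} b → derive b (blank {i} {j}) ≡ blank
derive-blank b = cong₂ _,_ (Vec.map-replicate (_>>= strip b) nothing _) (Vec.map-replicate (mapMaybe (strip b)) [] _)

height : Word → ℕ
height w = suc (length w)

heightᵐ : Maybe Word → ℕ
heightᵐ = maybe′ height 0

heightˢ : FinSet → ℕ
heightˢ = List.foldr (λ w h → height w ⊔ h) 0

maxᵛ : ∀ {A : Set} {k} → (A → ℕ) → Vec A k → ℕ
maxᵛ h = Vec.foldr′ (λ x m → h x ⊔ m) 0

depth : ∀ {i j} → Valuation i j → ℕ
depth (ρ , σ) = maxᵛ heightᵐ ρ ⊔ maxᵛ heightˢ σ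

maxᵛ-map : ∀ {A B : Set} {k n} {h : A → ℕ} {h′ : B → ℕ} {g : A → B} →
           (∀ x → h x ≤ suc n → h′ (g x) ≤ n) →
           (xs : Vec A k) → maxᵛ h xs ≤ suc n → maxᵛ h′ (Vec.map g xs) ≤ n
maxᵛ-map shrinks []       _     = z≤n
maxᵛ-map {h = h} shrinks (x ∷ xs) bound = ℕ.⊔-lub
  (shrinks x (ℕ.m⊔n≤o⇒m≤o (h x) _ bound)) (maxᵛ-map shrinks xs (ℕ.m⊔n≤o⇒n≤o (h x) _ bound))

maxᵛ-zero : ∀ {A : Set} {k} {h : A → ℕ} {c : A} → (∀ x → h x ≤ 0 → x ≡ c) →
            (xs : Vec A k) → maxᵛ h xs ≤ 0 → xs ≡ Vec.replicate k c
maxᵛ-zero is-c []       _     = refl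
maxᵛ-zero {h = h} is-c (x ∷ xs) bound =
  cong₂ _∷_ (is-c x (ℕ.m⊔n≤o⇒m≤o (h x) _ bound)) (maxᵛ-zero is-c xs (ℕ.m⊔n≤o⇒n≤o (h x) _ bound))

heightᵐ-strip : ∀ {n} b w → height w ≤ suc n → heightᵐ (strip b w) ≤ n
heightᵐ-strip false (false ∷ w) (s≤s bound) = bound
heightᵐ-strip true  (true ∷ w)  (s≤s bound) = bound
heightᵐ-strip false []          _           = z≤n
heightᵐ-strip false (true ∷ w)  _           = z≤n
heightᵐ-strip true  []          _           = z≤n
heightᵐ-strip true  (false ∷ w) _           = z≤n

heightᵐ-derive : ∀ {n} b m → heightᵐ m ≤ suc n → heightᵐ (m >>= strip b) ≤ n
heightᵐ-derive b nothing  _     = z≤n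
heightᵐ-derive b (just w) bound = heightᵐ-strip b w bound

heightˢ-derive : ∀ {n} b X → heightˢ X ≤ suc n → heightˢ (mapMaybe (strip b) X) ≤ n
heightˢ-derive b []      _     = z≤n
heightˢ-derive b (w ∷ X) bound with strip b w | heightᵐ-strip b w (ℕ.m⊔n≤o⇒m≤o (height w) (heightˢ X) bound)
... | nothing | _          = heightˢ-derive b X (ℕ.m⊔n≤o⇒n≤o (height w) (heightˢ X) bound)
... | just u  | height-u≤n = ℕ.⊔-lub height-u≤n (heightˢ-derive b X (ℕ.m⊔n≤o⇒n≤o (height w) (heightˢ X) bound))

depth-derive : ∀ {i j n} b (v : Valuation i j) → depth v ≤ suc n → depth (derive b v) ≤ n
depth-derive b (ρ , σ) bound = ℕ.⊔-lub
  (maxᵛ-map (heightᵐ-derive b) ρ (ℕ.m⊔n≤o⇒m≤o (maxᵛ heightᵐ ρ) _ bound))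
  (maxᵛ-map (heightˢ-derive b) σ (ℕ.m⊔n≤o⇒n≤o (maxᵛ heightᵐ ρ) _ bound))

heightᵐ-zero : ∀ m → heightᵐ m ≤ 0 → m ≡ nothing
heightᵐ-zero nothing _ = refl

heightˢ-zero : ∀ X → heightˢ X ≤ 0 → X ≡ []
heightˢ-zero []      _     = refl
heightˢ-zero (w ∷ X) bound with () ← ℕ.m⊔n≤o⇒m≤o (height w) (heightˢ X) bound

depth-zero : ∀ {i j} (v : Valuation i j) → depth v ≤ 0 → v ≡ blank
depth-zero (ρ , σ) bound = cong₂ _,_
  (maxᵛ-zero heightᵐ-zero ρ (ℕ.m⊔n≤o⇒m≤o (maxᵛ heightᵐ ρ) _ bound))
  (maxᵛ-zero heightˢ-zero σ (ℕ.m⊔n≤o⇒n≤o (maxᵛ heightᵐ ρ) _ bound))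

depth-induction : ∀ {i j} (P : Valuation i j → Set) → P blank →
                  (∀ v → P (derive false v) → P (derive true v) → P v) → ∀ v → P v
depth-induction P P-blank P-step v = go (depth v) v ℕ.≤-refl
  where
  go : ∀ n v → depth v ≤ n → P v
  go zero    v bound = subst P (sym (depth-zero v bound)) P-blank
  go (suc n) v bound = P-step v (go n (derive false v) (depth-derive false v bound))
                                (go n (derive true v) (depth-derive true v bound))

record Automaton (i j : ℕ) : Set₁ where
  field
    States    : Finite
    step      : Label i j → Carrier States → Carrier States → Carrier States
    idle      : Carrier States
    step-idle : step blankLabel idle idle ≡ idle

  State : Set
  State = Carrier States

open Automaton using (States; State; step; idle; step-idle)

module _ {i j : ℕ} (A : Automaton i j) where

  run : ℕ → Valuation i j → State A
  run zero    v = idle A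
  run (suc n) v = step A (label v) (run n (derive false v)) (run n (derive true v))

  run-blank : ∀ n → run n blank ≡ idle A
  run-blank zero    = refl
  run-blank (suc n) = begin
    step A (label blank) (run n (derive false blank)) (run n (derive true blank))
      ≡⟨ cong₂ (step A (label blank)) (run-derive-blank false) (run-derive-blank true) ⟩
    step A (label blank) (idle A) (idle A)  ≡⟨ cong (λ l → step A l (idle A) (idle A)) label-blank ⟩
    step A blankLabel (idle A) (idle A)     ≡⟨ step-idle A ⟩
    idle A                                  ∎
    where
    open ≡-Reasoning
    run-derive-blank : ∀ b → run n (derive b blank) ≡ idle A
    run-derive-blank b = trans (cong (run n) (derive-blank b)) (run-blank n)

  run-stable : ∀ {n m} v → depth v ≤ n → n ≤ m → run m v ≡ run n v
  run-stable {zero} {m} v bound _ rewrite depth-zero v bound = run-blank m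
  run-stable {suc n} {suc m} v bound (s≤s n≤m) = cong₂ (step A (label v))
    (run-stable (derive false v) (depth-derive false v bound) n≤m)
    (run-stable (derive true v) (depth-derive true v bound) n≤m)

  -- Opaque: letting the type checker unfold runs on concrete valuations makes it blow up.
  opaque
    state : Valuation i j → State A
    state v = run (depth v) v

    run-state : ∀ {n} v → depth v ≤ n → run n v ≡ state v
    run-state v bound = run-stable v ℕ.≤-refl bound

    state-blank : state blank ≡ idle A
    state-blank = run-blank (depth (blank {i} {j}))

    state-unfold : ∀ v → state v ≡ step A (label v) (state (derive false v)) (state (derive true v))
    state-unfold v = trans (sym (run-stable v ℕ.≤-refl (ℕ.n≤1+n (depth v)))) (cong₂ (step A (label v))
      (run-state (derive false v) (depth-derive false v (ℕ.n≤1+n (depth v))))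
      (run-state (derive true v) (depth-derive true v (ℕ.n≤1+n (depth v)))))

  state-unique : (h : Valuation i j → State A) → h blank ≡ idle A →
                 (∀ v → h v ≡ step A (label v) (h (derive false v)) (h (derive true v))) →
                 ∀ v → state v ≡ h v
  state-unique h h-blank h-unfold = depth-induction (λ v → state v ≡ h v)
    (trans state-blank (sym h-blank))
    (λ v same₀ same₁ → trans (state-unfold v) (trans (cong₂ (step A (label v)) same₀ same₁) (sym (h-unfold v))))

  state-unfold-≡ : ∀ {v l v₀ v₁} → label v ≡ l → derive false v ≡ v₀ → derive true v ≡ v₁ →
                   state v ≡ step A l (state v₀) (state v₁)
  state-unfold-≡ {v} refl refl refl = state-unfold v

module _ {i j : ℕ} (Q : Finite) (h : Valuation i j → Carrier Q)
         (T : Label i j → Carrier Q → Carrier Q → Carrier Q)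
         (h-unfold : ∀ v → h v ≡ T (label v) (h (derive false v)) (h (derive true v))) where

  compositional : Automaton i j
  compositional = record { States = Q ; step = T ; idle = h blank ; step-idle = sym h-blank }
    where
    open ≡-Reasoning
    h-blank : h blank ≡ T blankLabel (h blank) (h blank)
    h-blank = begin
      h blank                                                   ≡⟨ h-unfold blank ⟩
      T (label blank) (h (derive false blank)) (h (derive true blank))
        ≡⟨ cong₂ (T (label blank)) (cong h (derive-blank false)) (cong h (derive-blank true)) ⟩
      T (label blank) (h blank) (h blank)                       ≡⟨ cong (λ l → T l (h blank) (h blank)) label-blank ⟩
      T blankLabel (h blank) (h blank)                          ∎

  state-compositional : ∀ v → state compositional v ≡ h v
  state-compositional = state-unique compositional h refl h-unfold

module _ {i j : ℕ} (A B : Automaton i j) where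

  private
    states : Valuation i j → State A × State B
    states v = state A v , state B v

    states-unfold : ∀ v → states v ≡ (step A (label v) (state A (derive false v)) (state A (derive true v)) ,
                                      step B (label v) (state B (derive false v)) (state B (derive true v)))
    states-unfold v = cong₂ _,_ (state-unfold A v) (state-unfold B v)

  _⊗_ : Automaton i j
  _⊗_ = compositional (States A ×ᶠ States B) states
    (λ l (p₀ , q₀) (p₁ , q₁) → step A l p₀ p₁ , step B l q₀ q₁) states-unfold

  state-⊗ : ∀ v → state _⊗_ v ≡ (state A v , state B v)
  state-⊗ = state-compositional _ states _ states-unfold

record Recognizer (i j : ℕ) : Set₁ where
  field
    automaton : Automaton i j
    Accept    : State automaton → Set
    accept?   : Decidable Accept

  Accepts : Valuation i j → Set
  Accepts v = Accept (state automaton v)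

open Recognizer using (automaton; Accept; accept?; Accepts)

complement : ∀ {i j} → Recognizer i j → Recognizer i j
complement R = record { automaton = automaton R ; Accept = ¬_ ∘ Accept R ; accept? = ¬? ∘ accept? R }

intersection : ∀ {i j} → Recognizer i j → Recognizer i j → Recognizer i j
intersection R R′ = record
  { automaton = automaton R ⊗ automaton R′
  ; Accept    = λ (q , q′) → Accept R q × Accept R′ q′
  ; accept?   = λ (q , q′) → accept? R q ×-dec accept? R′ q′
  }

data Verdict : Set where
  absent pending accepted rejected : Verdict

finite-Verdict : Finite
finite-Verdict = record
  { Carrier  = Verdict
  ; elements = absent ∷ pending ∷ accepted ∷ rejected ∷ []
  ; complete = λ { absent → here refl ; pending → there (here refl)
                 ; accepted → there (there (here refl)) ; rejected → there (there (there (here refl))) }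
  }

verdict : ∀ {P : Set} → Dec P → Verdict
verdict P? = if does P? then accepted else rejected

verdict-accepted : ∀ {P : Set} (P? : Dec P) → verdict P? ≡ accepted ⇔ P
verdict-accepted (yes p) = mk⇔ (λ _ → p) (λ _ → refl)
verdict-accepted (no ¬p) = mk⇔ (λ ()) (λ p → ⊥-elim (¬p p))

verdict-cong : ∀ {P Q : Set} → P ⇔ Q → (P? : Dec P) (Q? : Dec Q) → verdict P? ≡ verdict Q?
verdict-cong P⇔Q (yes _) (yes _) = refl
verdict-cong P⇔Q (no _)  (no _)  = refl
verdict-cong P⇔Q (yes p) (no ¬q) = ⊥-elim (¬q (Equivalence.to P⇔Q p))
verdict-cong P⇔Q (no ¬p) (yes q) = ⊥-elim (¬p (Equivalence.from P⇔Q q))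

-- At a node holding none of the atom's variables, these must all lie in one subtree,
-- whose verdict is passed up.
combine : Verdict → Verdict → Verdict
combine absent   absent   = absent
combine accepted absent   = accepted
combine absent   accepted = accepted
combine _        _        = rejected

combine-verdict : ∀ {P : Set} (P? : Dec P) → combine (verdict P?) absent ≡ verdict P?
combine-verdict (yes _) = refl
combine-verdict (no _)  = refl

combine-verdict′ : ∀ {P : Set} (P? : Dec P) → combine absent (verdict P?) ≡ verdict P?
combine-verdict′ (yes _) = refl
combine-verdict′ (no _)  = refl

infix 4 _≟ʷ_
_≟ʷ_ : DecidableEquality Word
_≟ʷ_ = List.≡-dec Bool._≟_

_≟ᵛ_ : DecidableEquality Verdict
_≟ᵛ_ = Finite._≟_ finite-Verdict

module _ {i j : ℕ} (x y : Fin i) (spec : Maybe Word → Maybe Word → Verdict)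
         (tr : Bool → Bool → Verdict → Verdict → Verdict)
         (spec-unfold : ∀ m m′ → spec m m′ ≡ tr (atRoot m) (atRoot m′)
                          (spec (m >>= strip false) (m′ >>= strip false))
                          (spec (m >>= strip true) (m′ >>= strip true))) where

  private
    spec-at : Valuation i j → Verdict
    spec-at (ρ , σ) = spec (Vec.lookup ρ x) (Vec.lookup ρ y)

    spec-at-unfold : ∀ v → spec-at v ≡ tr (Vec.lookup (proj₁ (label v)) x) (Vec.lookup (proj₁ (label v)) y)
                                         (spec-at (derive false v)) (spec-at (derive true v))
    spec-at-unfold (ρ , σ)
      rewrite Vec.lookup-map x atRoot ρ | Vec.lookup-map y atRoot ρ
            | Vec.lookup-map x (_>>= strip false) ρ | Vec.lookup-map y (_>>= strip false) ρ
            | Vec.lookup-map x (_>>= strip true) ρ | Vec.lookup-map y (_>>= strip true) ρ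
            = spec-unfold (Vec.lookup ρ x) (Vec.lookup ρ y)

  binaryAtom : Recognizer i j
  binaryAtom = record
    { automaton = compositional finite-Verdict spec-at
                    (λ l → tr (Vec.lookup (proj₁ l) x) (Vec.lookup (proj₁ l) y)) spec-at-unfold
    ; Accept    = _≡ accepted
    ; accept?   = _≟ᵛ accepted
    }

  state-binaryAtom : ∀ ρ σ → state (automaton binaryAtom) (ρ , σ) ≡ spec (Vec.lookup ρ x) (Vec.lookup ρ y)
  state-binaryAtom ρ σ = state-compositional _ spec-at _ spec-at-unfold (ρ , σ)

equalitySpec : Maybe Word → Maybe Word → Verdict
equalitySpec nothing  nothing  = absent
equalitySpec (just u) (just w) = verdict (u ≟ʷ w)
equalitySpec _        _        = rejected

equalityStep : Bool → Bool → Verdict → Verdict → Verdict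
equalityStep true  true  _  _  = accepted
equalityStep false false q₀ q₁ = combine q₀ q₁
equalityStep _     _     _  _  = rejected

equalitySpec-unfold : ∀ m m′ → equalitySpec m m′ ≡ equalityStep (atRoot m) (atRoot m′)
  (equalitySpec (m >>= strip false) (m′ >>= strip false)) (equalitySpec (m >>= strip true) (m′ >>= strip true))
equalitySpec-unfold nothing            nothing            = refl
equalitySpec-unfold nothing            (just [])          = refl
equalitySpec-unfold nothing            (just (false ∷ _)) = refl
equalitySpec-unfold nothing            (just (true ∷ _))  = refl
equalitySpec-unfold (just [])          nothing            = refl
equalitySpec-unfold (just (false ∷ _)) nothing            = refl
equalitySpec-unfold (just (true ∷ _))  nothing            = refl
equalitySpec-unfold (just [])          (just [])          = refl
equalitySpec-unfold (just [])          (just (_ ∷ _))     = refl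
equalitySpec-unfold (just (_ ∷ _))     (just [])          = refl
equalitySpec-unfold (just (false ∷ u)) (just (false ∷ w)) = sym (combine-verdict (u ≟ʷ w))
equalitySpec-unfold (just (false ∷ u)) (just (true ∷ w))  = refl
equalitySpec-unfold (just (true ∷ u))  (just (false ∷ w)) = refl
equalitySpec-unfold (just (true ∷ u))  (just (true ∷ w))  = sym (combine-verdict′ (u ≟ʷ w))

-- `pending`: the second variable sits at the root and the first one is absent, so the
-- parent of this subtree must hold the first variable.
successorSpec : Bool → Maybe Word → Maybe Word → Verdict
successorSpec b nothing  nothing   = absent
successorSpec b nothing  (just []) = pending
successorSpec b (just u) (just w)  = verdict (w ≟ʷ u ++ b ∷ [])
successorSpec b _        _         = rejected

successorStep : Bool → Bool → Bool → Verdict → Verdict → Verdict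
successorStep b     false false q₀      q₁      = combine q₀ q₁
successorStep b     false true  absent  absent  = pending
successorStep false true  false pending absent  = accepted
successorStep true  true  false absent  pending = accepted
successorStep _     _     _     _       _       = rejected

successorSpec-unfold : ∀ b m m′ → successorSpec b m m′ ≡ successorStep b (atRoot m) (atRoot m′)
  (successorSpec b (m >>= strip false) (m′ >>= strip false)) (successorSpec b (m >>= strip true) (m′ >>= strip true))
successorSpec-unfold b     nothing            nothing                = refl
successorSpec-unfold b     nothing            (just [])              = refl
successorSpec-unfold b     nothing            (just (false ∷ []))    = refl
successorSpec-unfold b     nothing            (just (false ∷ _ ∷ _)) = refl
successorSpec-unfold b     nothing            (just (true ∷ []))     = refl
successorSpec-unfold b     nothing            (just (true ∷ _ ∷ _))  = refl
successorSpec-unfold false (just [])          nothing                = refl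
successorSpec-unfold true  (just [])          nothing                = refl
successorSpec-unfold b     (just (false ∷ _)) nothing                = refl
successorSpec-unfold b     (just (true ∷ _))  nothing                = refl
successorSpec-unfold false (just [])          (just [])              = refl
successorSpec-unfold true  (just [])          (just [])              = refl
successorSpec-unfold false (just [])          (just (false ∷ []))    = refl
successorSpec-unfold false (just [])          (just (true ∷ []))     = refl
successorSpec-unfold true  (just [])          (just (false ∷ []))    = refl
successorSpec-unfold true  (just [])          (just (true ∷ []))     = refl
successorSpec-unfold false (just [])          (just (false ∷ _ ∷ _)) = refl
successorSpec-unfold false (just [])          (just (true ∷ _ ∷ _))  = refl
successorSpec-unfold true  (just [])          (just (false ∷ _ ∷ _)) = refl
successorSpec-unfold true  (just [])          (just (true ∷ _ ∷ _))  = refl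
successorSpec-unfold b     (just (false ∷ _)) (just [])              = refl
successorSpec-unfold b     (just (true ∷ _))  (just [])              = refl
successorSpec-unfold b     (just (false ∷ u)) (just (false ∷ w))     = sym (combine-verdict (w ≟ʷ u ++ b ∷ []))
successorSpec-unfold b     (just (false ∷ u)) (just (true ∷ w))      = refl
successorSpec-unfold b     (just (true ∷ u))  (just (false ∷ []))     = refl
successorSpec-unfold b     (just (true ∷ u))  (just (false ∷ _ ∷ _))  = refl
successorSpec-unfold b     (just (true ∷ u))  (just (true ∷ w))      = sym (combine-verdict′ (w ≟ʷ u ++ b ∷ []))

strip-just : ∀ b u {w} → strip b u ≡ just w → u ≡ b ∷ w
strip-just false (false ∷ u) refl = refl
strip-just true  (true ∷ u)  refl = refl
strip-just false []          ()
strip-just false (true ∷ u)  ()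
strip-just true  []          ()
strip-just true  (false ∷ u) ()

∈-strip : ∀ b w X → b ∷ w ∈ X ⇔ w ∈ mapMaybe (strip b) X
∈-strip b w X = mk⇔ (to b X) (from X)
  where
  to : ∀ b X → b ∷ w ∈ X → w ∈ mapMaybe (strip b) X
  to false (_ ∷ X) (here refl) = here refl
  to true  (_ ∷ X) (here refl) = here refl
  to b     (u ∷ X) (there w∈X) with strip b u
  ... | nothing = to b X w∈X
  ... | just _  = there (to b X w∈X)

  from : ∀ X → w ∈ mapMaybe (strip b) X → b ∷ w ∈ X
  from (u ∷ X) w∈ with strip b u in stripped
  ... | nothing = there (from X w∈)
  from (u ∷ X) (here refl) | just _ = here (sym (strip-just b u stripped))
  from (u ∷ X) (there w∈)  | just _ = there (from X w∈)

membershipSpec : Maybe Word → FinSet → Verdict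
membershipSpec nothing  X = absent
membershipSpec (just w) X = verdict (w ∈? X)

membershipStep : Bool → Bool → Verdict → Verdict → Verdict
membershipStep true  root _  _  = if root then accepted else rejected
membershipStep false _    q₀ q₁ = combine q₀ q₁

membershipSpec-unfold : ∀ m X → membershipSpec m X ≡ membershipStep (atRoot m) (containsRoot X)
  (membershipSpec (m >>= strip false) (mapMaybe (strip false) X))
  (membershipSpec (m >>= strip true) (mapMaybe (strip true) X))
membershipSpec-unfold nothing            X = refl
membershipSpec-unfold (just [])          X = refl
membershipSpec-unfold (just (false ∷ w)) X =
  trans (verdict-cong (∈-strip false w X) (false ∷ w ∈? X) (w ∈? mapMaybe (strip false) X)) (sym (combine-verdict (w ∈? mapMaybe (strip false) X)))
membershipSpec-unfold (just (true ∷ w))  X =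
  trans (verdict-cong (∈-strip true w X) (true ∷ w ∈? X) (w ∈? mapMaybe (strip true) X)) (sym (combine-verdict′ (w ∈? mapMaybe (strip true) X)))

module _ {i j : ℕ} (x : Fin i) (X : Fin j) where

  private
    spec-at : Valuation i j → Verdict
    spec-at (ρ , σ) = membershipSpec (Vec.lookup ρ x) (Vec.lookup σ X)

    spec-at-unfold : ∀ v → spec-at v ≡ membershipStep (Vec.lookup (proj₁ (label v)) x) (Vec.lookup (proj₂ (label v)) X)
                                         (spec-at (derive false v)) (spec-at (derive true v))
    spec-at-unfold (ρ , σ)
      rewrite Vec.lookup-map x atRoot ρ | Vec.lookup-map X containsRoot σ
            | Vec.lookup-map x (_>>= strip false) ρ | Vec.lookup-map X (mapMaybe (strip false)) σ
            | Vec.lookup-map x (_>>= strip true) ρ | Vec.lookup-map X (mapMaybe (strip true)) σ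
            = membershipSpec-unfold (Vec.lookup ρ x) (Vec.lookup σ X)

  membershipAtom : Recognizer i j
  membershipAtom = record
    { automaton = compositional finite-Verdict spec-at
                    (λ l → membershipStep (Vec.lookup (proj₁ l) x) (Vec.lookup (proj₂ l) X)) spec-at-unfold
    ; Accept    = _≡ accepted
    ; accept?   = _≟ᵛ accepted
    }

  state-membershipAtom : ∀ ρ σ → state (automaton membershipAtom) (ρ , σ) ≡ membershipSpec (Vec.lookup ρ x) (Vec.lookup σ X)
  state-membershipAtom ρ σ = state-compositional _ spec-at _ spec-at-unfold (ρ , σ)

markWord : ∀ {i j} → Bool → Label i j → Label (suc i) j
markWord b (lρ , lσ) = b ∷ lρ , lσ

extendWord : ∀ {i j} → Maybe Word → Valuation i j → Valuation (suc i) j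
extendWord m (ρ , σ) = m ∷ ρ , σ

-- The projection runs R's automaton with the new variable absent and, alongside, the set of states
-- reachable by placing it anywhere in the subtree; on blank subtrees that set is a closure.
module ExistsWord {i j : ℕ} (R : Recognizer (suc i) j) where

  private
    A : Automaton (suc i) j
    A = automaton R

    Q : Finite
    Q = States A

    open Finite Q using (_≟_; any?; _∈ᶠ_; _∈ᶠ?_; subsetOf; ∈-subsetOf; ∈ˢ-subsetOf)

  unmarked : Valuation i j → State A
  unmarked v = state A (extendWord nothing v)

  marked : Word → Valuation i j → State A
  marked u v = state A (extendWord (just u) v)

  Reachable : Valuation i j → Pred (State A) 0ℓ
  Reachable v q = ∃ λ u → marked u v ≡ q

  Marked : Label i j → State A → State A → (P₀ P₁ : Pred (State A) 0ℓ) → Pred (State A) 0ℓ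
  Marked l n₀ n₁ P₀ P₁ q = step A (markWord true l) n₀ n₁ ≡ q
                         ⊎ (∃ λ a → P₀ a × step A (markWord false l) a n₁ ≡ q)
                         ⊎ (∃ λ a → P₁ a × step A (markWord false l) n₀ a ≡ q)

  Marked-cong : ∀ {l n₀ n₀′ n₁ n₁′ P₀ P₀′ P₁ P₁′ q} → n₀ ≡ n₀′ → n₁ ≡ n₁′ →
                (∀ {a} → P₀ a → P₀′ a) → (∀ {a} → P₁ a → P₁′ a) →
                Marked l n₀ n₁ P₀ P₁ q → Marked l n₀′ n₁′ P₀′ P₁′ q
  Marked-cong refl refl _ _ (inj₁ root)                      = inj₁ root
  Marked-cong refl refl f _ (inj₂ (inj₁ (a , P₀a , stepped))) = inj₂ (inj₁ (a , f P₀a , stepped))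
  Marked-cong refl refl _ g (inj₂ (inj₂ (a , P₁a , stepped))) = inj₂ (inj₂ (a , g P₁a , stepped))

  Marked? : ∀ l n₀ n₁ {P₀ P₁} → Decidable P₀ → Decidable P₁ → Decidable (Marked l n₀ n₁ P₀ P₁)
  Marked? l n₀ n₁ P₀? P₁? q =
    (step A (markWord true l) n₀ n₁ ≟ q)
    ⊎-dec any? (λ a → P₀? a ×-dec (step A (markWord false l) a n₁ ≟ q))
    ⊎-dec any? (λ a → P₁? a ×-dec (step A (markWord false l) n₀ a ≟ q))

  marked-unfold-≡ : ∀ {v l v₀ v₁} → label v ≡ l → derive false v ≡ v₀ → derive true v ≡ v₁ →
                    ∀ u → marked u v ≡ step A (markWord (atRoot (just u)) l)
                                          (state A (extendWord (strip false u) v₀))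
                                          (state A (extendWord (strip true u) v₁))
  marked-unfold-≡ {v} refl refl refl u = state-unfold A (extendWord (just u) v)

  reachable⇔marked-≡ : ∀ {v l v₀ v₁} → label v ≡ l → derive false v ≡ v₀ → derive true v ≡ v₁ →
                       ∀ q → Reachable v q ⇔ Marked l (unmarked v₀) (unmarked v₁) (Reachable v₀) (Reachable v₁) q
  reachable⇔marked-≡ {v} {l} {v₀} {v₁} l≡ v₀≡ v₁≡ q = mk⇔ to from
    where
    unfold : ∀ u → marked u v ≡ step A (markWord (atRoot (just u)) l)
                                  (state A (extendWord (strip false u) v₀)) (state A (extendWord (strip true u) v₁))
    unfold = marked-unfold-≡ l≡ v₀≡ v₁≡

    to : ∀ {q} → Reachable v q → Marked l (unmarked v₀) (unmarked v₁) (Reachable v₀) (Reachable v₁) q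
    to ([]        , refl) = inj₁ (sym (unfold []))
    to (false ∷ u , refl) = inj₂ (inj₁ (_ , (u , refl) , sym (unfold (false ∷ u))))
    to (true ∷ u  , refl) = inj₂ (inj₂ (_ , (u , refl) , sym (unfold (true ∷ u))))

    from : ∀ {q} → Marked l (unmarked v₀) (unmarked v₁) (Reachable v₀) (Reachable v₁) q → Reachable v q
    from (inj₁ stepped)                           = []        , trans (unfold []) stepped
    from (inj₂ (inj₁ (_ , (u , refl) , stepped))) = false ∷ u , trans (unfold (false ∷ u)) stepped
    from (inj₂ (inj₂ (_ , (u , refl) , stepped))) = true ∷ u  , trans (unfold (true ∷ u)) stepped

  markStep : Label i j → State A → State A → (p₀ p₁ : Subset (size Q)) → Subset (size Q)
  markStep l n₀ n₁ p₀ p₁ = subsetOf (Marked? l n₀ n₁ (_∈ᶠ? p₀) (_∈ᶠ? p₁))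

  ∈ˢ-markStep : ∀ {l n₀ n₁ p₀ p₁ k} → k ∈ˢ markStep l n₀ n₁ p₀ p₁ ⇔ Marked l n₀ n₁ (_∈ᶠ p₀) (_∈ᶠ p₁) (decode Q k)
  ∈ˢ-markStep {l} {n₀} {n₁} {p₀} {p₁} = ∈ˢ-subsetOf (Marked? l n₀ n₁ (_∈ᶠ? p₀) (_∈ᶠ? p₁))

  ∈-markStep : ∀ {l n₀ n₁ p₀ p₁ q} → q ∈ᶠ markStep l n₀ n₁ p₀ p₁ ⇔ Marked l n₀ n₁ (_∈ᶠ p₀) (_∈ᶠ p₁) q
  ∈-markStep {l} {n₀} {n₁} {p₀} {p₁} = ∈-subsetOf (Marked? l n₀ n₁ (_∈ᶠ? p₀) (_∈ᶠ? p₁))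

  private
    F : Subset (size Q) → Subset (size Q)
    F p = markStep blankLabel (unmarked blank) (unmarked blank) p p

    F-mono : ∀ {p p′} → p ⊆ p′ → F p ⊆ F p′
    F-mono p⊆p′ k∈ = Equivalence.from ∈ˢ-markStep
      (Marked-cong refl refl p⊆p′ p⊆p′ (Equivalence.to ∈ˢ-markStep k∈))

  open Closure F F-mono ∅ (⊥-elim ∘ Subset.∉⊥) using (closure; F-closure; closure-induction)

  projection : Automaton i j
  projection = record
    { States    = Q ×ᶠ Subsetᶠ Q
    ; step      = λ l (n₀ , p₀) (n₁ , p₁) → step A (markWord false l) n₀ n₁ , markStep l n₀ n₁ p₀ p₁
    ; idle      = idle A , closure
    ; step-idle = cong₂ _,_ (step-idle A)
                    (subst (λ n → markStep blankLabel n n closure closure ≡ closure) (state-blank A) F-closure)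
    }

  private
    reachable-closure : ∀ u → marked u blank ∈ᶠ closure
    reachable-closure u = subst (marked u blank ∈ᶠ_) F-closure (Equivalence.from ∈-markStep (marks u))
      where
      unfold : ∀ u → marked u blank ≡ step A (markWord (atRoot (just u)) blankLabel)
                       (state A (extendWord (strip false u) blank)) (state A (extendWord (strip true u) blank))
      unfold = marked-unfold-≡ label-blank (derive-blank false) (derive-blank true)

      marks : ∀ u → Marked blankLabel (unmarked blank) (unmarked blank) (_∈ᶠ closure) (_∈ᶠ closure) (marked u blank)
      marks []          = inj₁ (sym (unfold []))
      marks (false ∷ u) = inj₂ (inj₁ (_ , reachable-closure u , sym (unfold (false ∷ u))))
      marks (true ∷ u)  = inj₂ (inj₂ (_ , reachable-closure u , sym (unfold (true ∷ u))))

    closure-reachable : ∀ {k} → k ∈ˢ closure → Reachable blank (decode Q k)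
    closure-reachable = closure-induction (Reachable blank ∘ decode Q) (⊥-elim ∘ Subset.∉⊥) λ p reach k∈ →
      Equivalence.from (reachable⇔marked-≡ label-blank (derive-blank false) (derive-blank true) _)
        (Marked-cong refl refl (reach′ reach) (reach′ reach) (Equivalence.to ∈ˢ-markStep k∈))
      where
      reach′ : ∀ {p} → (∀ {k} → k ∈ˢ p → Reachable blank (decode Q k)) → ∀ {a} → a ∈ᶠ p → Reachable blank a
      reach′ reach {a} a∈ = subst (Reachable blank) (decode-index Q a) (reach a∈)

  closure⇔reachable : ∀ q → q ∈ᶠ closure ⇔ Reachable blank q
  closure⇔reachable q = mk⇔ (subst (Reachable blank) (decode-index Q q) ∘ closure-reachable)
                            (λ (u , reached) → subst (_∈ᶠ closure) reached (reachable-closure u))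

  Invariant : Valuation i j → Set
  Invariant v = proj₁ (state projection v) ≡ unmarked v
              × (∀ q → q ∈ᶠ proj₂ (state projection v) ⇔ Reachable v q)

  invariant : ∀ v → Invariant v
  invariant = depth-induction Invariant blank-case step-case
    where
    Invariant′ : Valuation i j → State projection → Set
    Invariant′ v (n , p) = n ≡ unmarked v × (∀ q → q ∈ᶠ p ⇔ Reachable v q)

    blank-case : Invariant blank
    blank-case = subst (Invariant′ blank) (sym (state-blank projection))
                   (sym (state-blank A) , closure⇔reachable)

    step-case : ∀ v → Invariant (derive false v) → Invariant (derive true v) → Invariant v
    step-case v (n₀≡ , p₀⇔) (n₁≡ , p₁⇔) = subst (Invariant′ v) (sym (state-unfold projection v))
      ( trans (cong₂ (step A (markWord false (label v))) n₀≡ n₁≡) (sym (state-unfold A (extendWord nothing v)))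
      , λ q → mk⇔
          (Equivalence.from (reachable⇔marked-≡ refl refl refl q)
            ∘ Marked-cong n₀≡ n₁≡ (Equivalence.to (p₀⇔ _)) (Equivalence.to (p₁⇔ _)) ∘ Equivalence.to ∈-markStep)
          (Equivalence.from ∈-markStep
            ∘ Marked-cong (sym n₀≡) (sym n₁≡) (Equivalence.from (p₀⇔ _)) (Equivalence.from (p₁⇔ _))
            ∘ Equivalence.to (reachable⇔marked-≡ refl refl refl q)))

  existsWord : Recognizer i j
  existsWord = record
    { automaton = projection
    ; Accept    = λ (_ , p) → ∃ λ a → a ∈ᶠ p × Accept R a
    ; accept?   = λ (_ , p) → any? (λ a → (a ∈ᶠ? p) ×-dec accept? R a)
    }

  accepts-existsWord : ∀ v → Accepts existsWord v ⇔ ∃ λ u → Accepts R (extendWord (just u) v)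
  accepts-existsWord v = mk⇔
    (λ (a , a∈ , accepts) → let (u , reached) = Equivalence.to (proj₂ (invariant v) a) a∈
                            in u , subst (Accept R) (sym reached) accepts)
    (λ (u , accepts) → marked u v , Equivalence.from (proj₂ (invariant v) _) (u , refl) , accepts)

markSet : ∀ {i j} → Bool → Label i j → Label i (suc j)
markSet b (lρ , lσ) = lρ , b ∷ lσ

extendSet : ∀ {i j} → FinSet → Valuation i j → Valuation i (suc j)
extendSet X (ρ , σ) = ρ , X ∷ σ

graft : Bool → FinSet → FinSet → FinSet
graft false X₀ X₁ = List.map (false ∷_) X₀ ++ List.map (true ∷_) X₁
graft true  X₀ X₁ = [] ∷ graft false X₀ X₁

strip-graft₀ : ∀ r X₀ X₁ → mapMaybe (strip false) (graft r X₀ X₁) ≡ X₀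
strip-graft₀ true  X₀ X₁ = strip-graft₀ false X₀ X₁
strip-graft₀ false X₀ X₁ = begin
  mapMaybe (strip false) (List.map (false ∷_) X₀ ++ List.map (true ∷_) X₁)
    ≡⟨ List.mapMaybe-++ (strip false) (List.map (false ∷_) X₀) _ ⟩
  mapMaybe (strip false) (List.map (false ∷_) X₀) ++ mapMaybe (strip false) (List.map (true ∷_) X₁)
    ≡⟨ cong₂ _++_ (List.mapMaybe-map-retract (λ _ → refl) X₀) (List.mapMaybe-map-none (λ _ → refl) X₁) ⟩
  X₀ ++ []
    ≡⟨ List.++-identityʳ X₀ ⟩
  X₀ ∎
  where open ≡-Reasoning

strip-graft₁ : ∀ r X₀ X₁ → mapMaybe (strip true) (graft r X₀ X₁) ≡ X₁
strip-graft₁ true  X₀ X₁ = strip-graft₁ false X₀ X₁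
strip-graft₁ false X₀ X₁ = begin
  mapMaybe (strip true) (List.map (false ∷_) X₀ ++ List.map (true ∷_) X₁)
    ≡⟨ List.mapMaybe-++ (strip true) (List.map (false ∷_) X₀) _ ⟩
  mapMaybe (strip true) (List.map (false ∷_) X₀) ++ mapMaybe (strip true) (List.map (true ∷_) X₁)
    ≡⟨ cong₂ _++_ (List.mapMaybe-map-none (λ _ → refl) X₀) (List.mapMaybe-map-retract (λ _ → refl) X₁) ⟩
  X₁ ∎
  where open ≡-Reasoning

containsRoot-graft : ∀ r X₀ X₁ → containsRoot (graft r X₀ X₁) ≡ r
containsRoot-graft true  X₀ X₁ = refl
containsRoot-graft false X₀ X₁ = dec-false ([] ∈? graft false X₀ X₁) root∉
  where
  root∉ : ¬ ([] ∈ graft false X₀ X₁)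
  root∉ []∈ with ∈-++⁻ (List.map (false ∷_) X₀) []∈
  ... | inj₁ []∈₀ with () ← proj₂ (proj₂ (∈-map⁻ (false ∷_) []∈₀))
  ... | inj₂ []∈₁ with () ← proj₂ (proj₂ (∈-map⁻ (true ∷_) []∈₁))

module ExistsSet {i j : ℕ} (R : Recognizer i (suc j)) where

  private
    A : Automaton i (suc j)
    A = automaton R

    Q : Finite
    Q = States A

    open Finite Q using (_≟_; any?; _∈ᶠ_; _∈ᶠ?_; subsetOf; ∈-subsetOf; ∈ˢ-subsetOf)

  Reachable : Valuation i j → Pred (State A) 0ℓ
  Reachable v q = ∃ λ X → state A (extendSet X v) ≡ q

  Grafted : Label i j → (P₀ P₁ : Pred (State A) 0ℓ) → Pred (State A) 0ℓ
  Grafted l P₀ P₁ q = ∃ λ r → ∃₂ λ a₀ a₁ → P₀ a₀ × P₁ a₁ × step A (markSet r l) a₀ a₁ ≡ q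

  Grafted-mono : ∀ {l P₀ P₀′ P₁ P₁′ q} → (∀ {a} → P₀ a → P₀′ a) → (∀ {a} → P₁ a → P₁′ a) →
                 Grafted l P₀ P₁ q → Grafted l P₀′ P₁′ q
  Grafted-mono f g (r , a₀ , a₁ , P₀a₀ , P₁a₁ , stepped) = r , a₀ , a₁ , f P₀a₀ , g P₁a₁ , stepped

  Grafted? : ∀ l {P₀ P₁} → Decidable P₀ → Decidable P₁ → Decidable (Grafted l P₀ P₁)
  Grafted? l P₀? P₁? q = Finite.any? finite-Bool λ r → any? λ a₀ → any? λ a₁ →
    P₀? a₀ ×-dec P₁? a₁ ×-dec (step A (markSet r l) a₀ a₁ ≟ q)

  state-unfold-extendSet : ∀ {v l v₀ v₁} → label v ≡ l → derive false v ≡ v₀ → derive true v ≡ v₁ →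
    ∀ X → state A (extendSet X v) ≡ step A (markSet (containsRoot X) l)
                                          (state A (extendSet (mapMaybe (strip false) X) v₀))
                                          (state A (extendSet (mapMaybe (strip true) X) v₁))
  state-unfold-extendSet {v} refl refl refl X = state-unfold A (extendSet X v)

  reachable⇔grafted-≡ : ∀ {v l v₀ v₁} → label v ≡ l → derive false v ≡ v₀ → derive true v ≡ v₁ →
                        ∀ q → Reachable v q ⇔ Grafted l (Reachable v₀) (Reachable v₁) q
  reachable⇔grafted-≡ {v} {l} {v₀} {v₁} l≡ v₀≡ v₁≡ q = mk⇔ to from
    where
    unfold : ∀ X → state A (extendSet X v) ≡ step A (markSet (containsRoot X) l)
                     (state A (extendSet (mapMaybe (strip false) X) v₀)) (state A (extendSet (mapMaybe (strip true) X) v₁))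
    unfold = state-unfold-extendSet l≡ v₀≡ v₁≡

    to : ∀ {q} → Reachable v q → Grafted l (Reachable v₀) (Reachable v₁) q
    to (X , refl) = containsRoot X , _ , _ , (mapMaybe (strip false) X , refl) , (mapMaybe (strip true) X , refl) ,
                    sym (unfold X)

    state-graft : ∀ r X₀ X₁ → state A (extendSet (graft r X₀ X₁) v) ≡
                              step A (markSet r l) (state A (extendSet X₀ v₀)) (state A (extendSet X₁ v₁))
    state-graft r X₀ X₁
      rewrite unfold (graft r X₀ X₁) | containsRoot-graft r X₀ X₁ | strip-graft₀ r X₀ X₁ | strip-graft₁ r X₀ X₁
      = refl

    from : ∀ {q} → Grafted l (Reachable v₀) (Reachable v₁) q → Reachable v q
    from (r , _ , _ , (X₀ , refl) , (X₁ , refl) , stepped) = graft r X₀ X₁ , trans (state-graft r X₀ X₁) stepped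

  graftStep : Label i j → (p₀ p₁ : Subset (size Q)) → Subset (size Q)
  graftStep l p₀ p₁ = subsetOf (Grafted? l (_∈ᶠ? p₀) (_∈ᶠ? p₁))

  ∈ˢ-graftStep : ∀ {l p₀ p₁ k} → k ∈ˢ graftStep l p₀ p₁ ⇔ Grafted l (_∈ᶠ p₀) (_∈ᶠ p₁) (decode Q k)
  ∈ˢ-graftStep {l} {p₀} {p₁} = ∈ˢ-subsetOf (Grafted? l (_∈ᶠ? p₀) (_∈ᶠ? p₁))

  ∈-graftStep : ∀ {l p₀ p₁ q} → q ∈ᶠ graftStep l p₀ p₁ ⇔ Grafted l (_∈ᶠ p₀) (_∈ᶠ p₁) q
  ∈-graftStep {l} {p₀} {p₁} = ∈-subsetOf (Grafted? l (_∈ᶠ? p₀) (_∈ᶠ? p₁))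

  private
    unfold-blank : ∀ X → state A (extendSet X blank) ≡ step A (markSet (containsRoot X) blankLabel)
                           (state A (extendSet (mapMaybe (strip false) X) blank))
                           (state A (extendSet (mapMaybe (strip true) X) blank))
    unfold-blank = state-unfold-extendSet label-blank (derive-blank false) (derive-blank true)

    emptyState : State A
    emptyState = state A (extendSet [] blank)

    F : Subset (size Q) → Subset (size Q)
    F p = graftStep blankLabel p p

    F-mono : ∀ {p p′} → p ⊆ p′ → F p ⊆ F p′
    F-mono p⊆p′ k∈ = Equivalence.from ∈ˢ-graftStep
      (Grafted-mono p⊆p′ p⊆p′ (Equivalence.to ∈ˢ-graftStep k∈))

    base : Subset (size Q)
    base = subsetOf (_≟ emptyState)

    emptyState∈base : emptyState ∈ᶠ base
    emptyState∈base = Equivalence.from (∈-subsetOf (_≟ emptyState)) refl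

    base⊆F : base ⊆ F base
    base⊆F k∈ = Equivalence.from ∈ˢ-graftStep
      (false , emptyState , emptyState , emptyState∈base , emptyState∈base ,
       trans (sym (unfold-blank [])) (sym (Equivalence.to (∈ˢ-subsetOf (_≟ emptyState)) k∈)))

  open Closure F F-mono base base⊆F using (closure; F-closure; base⊆closure; closure-induction)


  private
    reachable-closure : ∀ X → state A (extendSet X blank) ∈ᶠ closure
    reachable-closure X = go (heightˢ X) X ℕ.≤-refl
      where
      go : ∀ n X → heightˢ X ≤ n → state A (extendSet X blank) ∈ᶠ closure
      go zero X bound = subst (λ Y → state A (extendSet Y blank) ∈ᶠ closure) (sym (heightˢ-zero X bound))
                          (base⊆closure emptyState∈base)
      go (suc n) X bound = subst (state A (extendSet X blank) ∈ᶠ_) F-closure (Equivalence.from ∈-graftStep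
        (containsRoot X , _ , _ , go n _ (heightˢ-derive false X bound) , go n _ (heightˢ-derive true X bound) ,
         sym (unfold-blank X)))

    closure-reachable : ∀ {k} → k ∈ˢ closure → Reachable blank (decode Q k)
    closure-reachable = closure-induction (Reachable blank ∘ decode Q)
      (λ k∈ → [] , sym (Equivalence.to (∈ˢ-subsetOf (_≟ emptyState)) k∈))
      (λ p reach k∈ → Equivalence.from (reachable⇔grafted-≡ label-blank (derive-blank false) (derive-blank true) _)
        (Grafted-mono (reach′ reach) (reach′ reach) (Equivalence.to ∈ˢ-graftStep k∈)))
      where
      reach′ : ∀ {p} → (∀ {k} → k ∈ˢ p → Reachable blank (decode Q k)) → ∀ {a} → a ∈ᶠ p → Reachable blank a
      reach′ reach {a} a∈ = subst (Reachable blank) (decode-index Q a) (reach a∈)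

  closure⇔reachable : ∀ q → q ∈ᶠ closure ⇔ Reachable blank q
  closure⇔reachable q = mk⇔ (subst (Reachable blank) (decode-index Q q) ∘ closure-reachable)
                            (λ (X , reached) → subst (_∈ᶠ closure) reached (reachable-closure X))

  projection : Automaton i j
  projection = record { States = Subsetᶠ Q ; step = graftStep ; idle = closure ; step-idle = F-closure }

  Invariant : Valuation i j → Set
  Invariant v = ∀ q → q ∈ᶠ state projection v ⇔ Reachable v q

  invariant : ∀ v → Invariant v
  invariant = depth-induction Invariant blank-case step-case
    where
    Invariant′ : Valuation i j → State projection → Set
    Invariant′ v p = ∀ q → q ∈ᶠ p ⇔ Reachable v q

    blank-case : Invariant blank
    blank-case = subst (Invariant′ blank) (sym (state-blank projection)) closure⇔reachable

    step-case : ∀ v → Invariant (derive false v) → Invariant (derive true v) → Invariant v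
    step-case v p₀⇔ p₁⇔ = subst (Invariant′ v) (sym (state-unfold projection v)) λ q → mk⇔
      (Equivalence.from (reachable⇔grafted-≡ refl refl refl q)
        ∘ Grafted-mono (Equivalence.to (p₀⇔ _)) (Equivalence.to (p₁⇔ _)) ∘ Equivalence.to ∈-graftStep)
      (Equivalence.from ∈-graftStep
        ∘ Grafted-mono (Equivalence.from (p₀⇔ _)) (Equivalence.from (p₁⇔ _))
        ∘ Equivalence.to (reachable⇔grafted-≡ refl refl refl q))

  existsSet : Recognizer i j
  existsSet = record
    { automaton = projection
    ; Accept    = λ p → ∃ λ a → a ∈ᶠ p × Accept R a
    ; accept?   = λ p → any? (λ a → (a ∈ᶠ? p) ×-dec accept? R a)
    }

  accepts-existsSet : ∀ v → Accepts existsSet v ⇔ ∃ λ X → Accepts R (extendSet X v)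
  accepts-existsSet v = mk⇔
    (λ (a , a∈ , accepts) → let (X , reached) = Equivalence.to (invariant v a) a∈
                            in X , subst (Accept R) (sym reached) accepts)
    (λ (X , accepts) → state A (extendSet X v) , Equivalence.from (invariant v _) (X , refl) , accepts)

compile : ∀ {i j} → WMSO i j → Recognizer i j
compile (S b x y) = binaryAtom x y (successorSpec b) (successorStep b) (successorSpec-unfold b)
compile (eq x y)  = binaryAtom x y equalitySpec equalityStep equalitySpec-unfold
compile (mem x X) = membershipAtom x X
compile (neg φ)   = complement (compile φ)
compile (and φ ψ) = intersection (compile φ) (compile ψ)
compile (ex1 φ)   = ExistsWord.existsWord (compile φ)
compile (ex2 φ)   = ExistsSet.existsSet (compile φ)

valuation : ∀ {i j} → (Fin i → Word) → (Fin j → FinSet) → Valuation i j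
valuation ρ σ = Vec.tabulate (just ∘ ρ) , Vec.tabulate σ

∃-⇔ : ∀ {A : Set} {P Q : A → Set} → (∀ x → P x ⇔ Q x) → ∃ P ⇔ ∃ Q
∃-⇔ P⇔Q = mk⇔ (map₂ (Equivalence.to (P⇔Q _))) (map₂ (Equivalence.from (P⇔Q _)))

verdict-accepted-≡ : ∀ {P : Set} {s : Verdict} (P? : Dec P) → s ≡ verdict P? → P ⇔ s ≡ accepted
verdict-accepted-≡ P? refl = ⇔.sym (verdict-accepted P?)

compile-correct : ∀ {i j} (φ : WMSO i j) ρ σ → Sat φ ρ σ ⇔ Accepts (compile φ) (valuation ρ σ)
compile-correct (S b x y) ρ σ = verdict-accepted-≡ (ρ y ≟ʷ ρ x ++ b ∷ []) (trans
  (state-binaryAtom x y (successorSpec b) (successorStep b) (successorSpec-unfold b) (Vec.tabulate (just ∘ ρ)) (Vec.tabulate σ))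
  (cong₂ (successorSpec b) (Vec.lookup∘tabulate (just ∘ ρ) x) (Vec.lookup∘tabulate (just ∘ ρ) y)))
compile-correct (eq x y) ρ σ = verdict-accepted-≡ (ρ x ≟ʷ ρ y) (trans
  (state-binaryAtom x y equalitySpec equalityStep equalitySpec-unfold (Vec.tabulate (just ∘ ρ)) (Vec.tabulate σ))
  (cong₂ equalitySpec (Vec.lookup∘tabulate (just ∘ ρ) x) (Vec.lookup∘tabulate (just ∘ ρ) y)))
compile-correct (mem x X) ρ σ = verdict-accepted-≡ (ρ x ∈? σ X) (trans
  (state-membershipAtom x X (Vec.tabulate (just ∘ ρ)) (Vec.tabulate σ))
  (cong₂ membershipSpec (Vec.lookup∘tabulate (just ∘ ρ) x) (Vec.lookup∘tabulate σ X)))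
compile-correct (neg φ) ρ σ = ¬-cong-⇔ (compile-correct φ ρ σ)
compile-correct (and φ ψ) ρ σ = subst (λ (p , q) → (Sat φ ρ σ × Sat ψ ρ σ) ⇔ (Accept (compile φ) p × Accept (compile ψ) q))
  (sym (state-⊗ (automaton (compile φ)) (automaton (compile ψ)) (valuation ρ σ)))
  (compile-correct φ ρ σ ×-⇔ compile-correct ψ ρ σ)
compile-correct (ex1 φ) ρ σ = ⇔.trans (∃-⇔ λ u → compile-correct φ (extend u ρ) σ)
  (⇔.sym (ExistsWord.accepts-existsWord (compile φ) (valuation ρ σ)))
compile-correct (ex2 φ) ρ σ = ⇔.trans (∃-⇔ λ X → compile-correct φ ρ (extend X σ))
  (⇔.sym (ExistsSet.accepts-existsSet (compile φ) (valuation ρ σ)))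

push : ∀ {i j} → Bool → Valuation i j → Valuation i j
push b (ρ , σ) = Vec.map (Maybe.map (b ∷_)) ρ , Vec.map (List.map (b ∷_)) σ

prefix : ∀ {i j} → Word → Valuation i j → Valuation i j
prefix z v = List.foldr push v z

map∘map-const : ∀ {A B C : Set} {n} {f : B → C} {g : A → B} {c : C} → (∀ x → f (g x) ≡ c) →
                (xs : Vec A n) → Vec.map f (Vec.map g xs) ≡ Vec.replicate n c
map∘map-const {f = f} {g} {c} fg≡c xs =
  trans (sym (Vec.map-∘ f g xs)) (trans (Vec.map-cong fg≡c xs) (Vec.map-const xs c))

map∘map-id : ∀ {A B : Set} {n} {f : B → A} {g : A → B} → (∀ x → f (g x) ≡ x) →
             (xs : Vec A n) → Vec.map f (Vec.map g xs) ≡ xs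
map∘map-id {f = f} {g} fg≡id xs =
  trans (sym (Vec.map-∘ f g xs)) (trans (Vec.map-cong fg≡id xs) (Vec.map-id xs))

strip-∷ : ∀ b w → strip b (b ∷ w) ≡ just w
strip-∷ false w = refl
strip-∷ true  w = refl

strip-not-∷ : ∀ b w → strip (not b) (b ∷ w) ≡ nothing
strip-not-∷ false w = refl
strip-not-∷ true  w = refl

label-push : ∀ {i j} b (v : Valuation i j) → label (push b v) ≡ blankLabel
label-push b (ρ , σ) = cong₂ _,_ (map∘map-const off-root ρ) (map∘map-const root∉ σ)
  where
  off-root : ∀ m → atRoot (Maybe.map (b ∷_) m) ≡ false
  off-root nothing  = refl
  off-root (just _) = refl
  root∉ : ∀ X → containsRoot (List.map (b ∷_) X) ≡ false
  root∉ X = dec-false ([] ∈? List.map (b ∷_) X) not-pushed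
    where
    not-pushed : ¬ ([] ∈ List.map (b ∷_) X)
    not-pushed []∈ with () ← proj₂ (proj₂ (∈-map⁻ (b ∷_) []∈))

derive-push : ∀ {i j} b (v : Valuation i j) → derive b (push b v) ≡ v
derive-push b (ρ , σ) = cong₂ _,_ (map∘map-id strip-push ρ) (map∘map-id (List.mapMaybe-map-retract (strip-∷ b)) σ)
  where
  strip-push : ∀ m → (Maybe.map (b ∷_) m >>= strip b) ≡ m
  strip-push nothing  = refl
  strip-push (just w) = strip-∷ b w

derive-not-push : ∀ {i j} b (v : Valuation i j) → derive (not b) (push b v) ≡ blank
derive-not-push b (ρ , σ) = cong₂ _,_ (map∘map-const strip-push ρ) (map∘map-const (List.mapMaybe-map-none (strip-not-∷ b)) σ)
  where
  strip-push : ∀ m → (Maybe.map (b ∷_) m >>= strip (not b)) ≡ nothing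
  strip-push nothing  = refl
  strip-push (just w) = strip-not-∷ b w

module _ {i j : ℕ} (A : Automaton i j) where

  pushState : Bool → State A → State A
  pushState false q = step A blankLabel q (idle A)
  pushState true  q = step A blankLabel (idle A) q

  act : Word → State A → State A
  act z q = List.foldr pushState q z

  state-push : ∀ b v → state A (push b v) ≡ pushState b (state A v)
  state-push false v = trans
    (state-unfold-≡ A (label-push false v) (derive-push false v) (derive-not-push false v))
    (cong (step A blankLabel (state A v)) (state-blank A))
  state-push true v = trans
    (state-unfold-≡ A (label-push true v) (derive-not-push true v) (derive-push true v))
    (cong (λ q → step A blankLabel q (state A v)) (state-blank A))

  state-prefix : ∀ z v → state A (prefix z v) ≡ act z (state A v)
  state-prefix []      v = refl
  state-prefix (b ∷ z) v = trans (state-push b (prefix z v)) (cong (pushState b) (state-prefix z v))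

prefix-words : ∀ {i} z (ms : Vec (Maybe Word) i) → prefix z (ms , []) ≡ (Vec.map (Maybe.map (z ++_)) ms , [])
prefix-words []      ms = cong (_, []) (sym (trans (Vec.map-cong map-[]++ ms) (Vec.map-id ms)))
  where
  map-[]++ : ∀ m → Maybe.map ([] ++_) m ≡ m
  map-[]++ nothing  = refl
  map-[]++ (just _) = refl
prefix-words (b ∷ z) ms = trans (cong (push b) (prefix-words z ms))
  (cong (_, []) (trans (sym (Vec.map-∘ _ _ ms)) (Vec.map-cong map-∷-map ms)))
  where
  map-∷-map : ∀ m → Maybe.map (b ∷_) (Maybe.map (z ++_) m) ≡ Maybe.map ((b ∷ z) ++_) m
  map-∷-map nothing  = refl
  map-∷-map (just _) = refl

state-prefix-words : ∀ {i} (A : Automaton i 0) z (ms : Vec (Maybe Word) i) →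
                     state A (Vec.map (Maybe.map (z ++_)) ms , []) ≡ act A z (state A (ms , []))
state-prefix-words A z ms = trans (cong (state A) (sym (prefix-words z ms))) (state-prefix A z (ms , []))

take-+ : ∀ {A : Set} i d (s : List A) → List.take (i + d) s ≡ List.take i s ++ List.take d (List.drop i s)
take-+ zero    d s       = refl
take-+ (suc i) d []      = sym (List.take-[] d)
take-+ (suc i) d (x ∷ s) = cong (x ∷_) (take-+ i d s)

drop-+ : ∀ {A : Set} i d (s : List A) → List.drop (i + d) s ≡ List.drop d (List.drop i s)
drop-+ zero    d s       = refl
drop-+ (suc i) d []      = sym (List.drop-[] d)
drop-+ (suc i) d (x ∷ s) = drop-+ i d s

module _ (P : Finite) where

  loop-decomposition : (g : Word → Word → Carrier P) (s : Word) → size P ≤ length s →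
    ∃₂ λ x y → ∃ λ z → s ≡ x ++ y ++ z × 0 < length y × g x (y ++ z) ≡ g (x ++ y) z
  loop-decomposition g s size≤ with i , j , i<j , same ← Finite.pigeonhole P (λ k → g (List.take (toℕ k) s) (List.drop (toℕ k) s))
    = x , y , z , s≡ , 0<|y| , collide
    where
    open ≡-Reasoning
    d : ℕ
    d = toℕ j ∸ toℕ i

    x r y z : Word
    x = List.take (toℕ i) s
    r = List.drop (toℕ i) s
    y = List.take d r
    z = List.drop d r

    j≡i+d : toℕ j ≡ toℕ i + d
    j≡i+d = sym (ℕ.m+[n∸m]≡n (ℕ.<⇒≤ i<j))

    s≡ : s ≡ x ++ y ++ z
    s≡ = trans (sym (List.take++drop≡id (toℕ i) s)) (cong (x ++_) (sym (List.take++drop≡id d r)))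

    0<|y| : 0 < length y
    0<|y| = subst (0 <_) (sym |y|≡d) (ℕ.m<n⇒0<n∸m i<j)
      where
      d≤|r| : d ≤ length r
      d≤|r| = subst (d ≤_) (sym (List.length-drop (toℕ i) s))
                (ℕ.∸-monoˡ-≤ (toℕ i) (ℕ.≤-trans (ℕ.≤-pred (Fin.toℕ<n j)) size≤))
      |y|≡d : length y ≡ d
      |y|≡d = trans (List.length-take d r) (ℕ.m≤n⇒m⊓n≡m d≤|r|)

    collide : g x (y ++ z) ≡ g (x ++ y) z
    collide = begin
      g x (y ++ z)                                          ≡⟨ cong (g x) (List.take++drop≡id d r) ⟩
      g x r                                                 ≡⟨ same ⟩
      g (List.take (toℕ j) s) (List.drop (toℕ j) s)         ≡⟨ cong (λ n → g (List.take n s) (List.drop n s)) j≡i+d ⟩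
      g (List.take (toℕ i + d) s) (List.drop (toℕ i + d) s) ≡⟨ cong₂ g (take-+ (toℕ i) d s) (drop-+ (toℕ i) d s) ⟩
      g (x ++ y) z                                          ∎

  pump-down : (H : Word → Carrier P) (F : Word → Carrier P → Carrier P) → (∀ x r → H (x ++ r) ≡ F x (H r)) →
              ∀ s → size P ≤ length s → ∃ λ s′ → length s′ < length s × H s′ ≡ H s
  pump-down H F H-++ s size≤ with x , y , z , refl , 0<|y| , loop ← loop-decomposition (λ _ r → H r) s size≤
    = x ++ z , shorter , same
    where
    shorter : length (x ++ z) < length (x ++ y ++ z)
    shorter = subst₂ _<_ (sym (List.length-++ x)) (sym (trans (List.length-++ x) (cong (length x +_) (List.length-++ y))))
      (ℕ.+-monoʳ-< (length x) (ℕ.m<n+m (length z) 0<|y|))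
    same : H (x ++ z) ≡ H (x ++ y ++ z)
    same = trans (H-++ x z) (trans (cong (F x) (sym loop)) (sym (H-++ x (y ++ z))))

shift-descent : ∀ (ℓ : ℕ → ℕ) e → ¬ (∀ k → ℓ (e + k) < ℓ k)
shift-descent ℓ e shrinks = ℕ.<-irrefl refl (ℕ.≤-trans (ℕ.m≤n+m (suc (ℓ 0)) _) (bound (suc (ℓ 0))))
  where
  bound : ∀ m → ℓ (m * e) + m ≤ ℓ 0
  bound zero    = ℕ.≤-reflexive (ℕ.+-identityʳ (ℓ 0))
  bound (suc m) = ℕ.≤-trans (ℕ.≤-reflexive (ℕ.+-suc (ℓ (e + m * e)) m))
                            (ℕ.≤-trans (ℕ.+-monoˡ-≤ m (shrinks (m * e))) (bound m))

shifted-longer⇒< : ∀ (ℓ : ℕ → ℕ) {a b} → (∀ k → ℓ (a + k) < ℓ (b + k)) → a < b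
shifted-longer⇒< ℓ {a} {b} longer with b ℕ.≤? a
... | no b≰a  = ℕ.≰⇒> b≰a
... | yes b≤a = ⊥-elim (shift-descent (λ k → ℓ (b + k)) (a ∸ b) λ k →
                  subst (λ c → ℓ c < ℓ (b + k)) (a+k≡ k) (longer k))
  where
  a+k≡ : ∀ k → a + k ≡ b + (a ∸ b + k)
  a+k≡ k = trans (cong (_+ k) (sym (ℕ.m+[n∸m]≡n b≤a))) (ℕ.+-assoc b (a ∸ b) k)

iterate-shift : ∀ {T : ℕ → Word} {n} y → (∀ k → T (n + k) ≡ y ++ T k) → ∀ k p → T (k * n + p) ≡ (y ^^ k) ++ T p
iterate-shift             y shift zero    p = refl
iterate-shift {T} {n} y shift (suc k) p = begin
  T (n + k * n + p)    ≡⟨ cong T (ℕ.+-assoc n (k * n) p) ⟩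
  T (n + (k * n + p))  ≡⟨ shift (k * n + p) ⟩
  y ++ T (k * n + p)     ≡⟨ cong (y ++_) (iterate-shift y shift k p) ⟩
  y ++ (y ^^ k) ++ T p       ≡⟨ List.++-assoc y (y ^^ k) (T p) ⟨
  (y ++ (y ^^ k)) ++ T p     ∎
  where open ≡-Reasoning

take-++ : ∀ {A : Set} {n} (x r : List A) → length x ≡ n → List.take n (x ++ r) ≡ x
take-++ []      r refl = refl
take-++ (a ∷ x) r refl = cong (a ∷_) (take-++ x r refl)

infix 4 _⊑?_
_⊑?_ : ∀ (w u : Word) → Dec (∃ λ r → w ++ r ≡ u)
[]      ⊑? u       = yes (u , refl)
(b ∷ w) ⊑? []      = no λ ()
(b ∷ w) ⊑? (c ∷ u) with b Bool.≟ c | w ⊑? u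
... | yes refl | yes (r , w++r≡u) = yes (r , cong (b ∷_) w++r≡u)
... | yes refl | no  w⋢u          = no λ (r , b∷w++r≡b∷u) → w⋢u (r , List.∷-injectiveʳ b∷w++r≡b∷u)
... | no  b≢c  | _                = no λ (r , b∷w++r≡c∷u) → b≢c (List.∷-injectiveˡ b∷w++r≡c∷u)

shortWords : ℕ → List Word
shortWords zero    = []
shortWords (suc n) = [] ∷ List.map (false ∷_) (shortWords n) ++ List.map (true ∷_) (shortWords n)

shortWords-complete : ∀ n w → length w < n → w ∈ shortWords n
shortWords-complete (suc n) []          _          = here refl
shortWords-complete (suc n) (false ∷ w) (s≤s |w|<n) =
  there (∈-++⁺ˡ (∈-map⁺ (false ∷_) (shortWords-complete n w |w|<n)))
shortWords-complete (suc n) (true ∷ w)  (s≤s |w|<n) =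
  there (∈-++⁺ʳ (List.map (false ∷_) (shortWords n)) (∈-map⁺ (true ∷_) (shortWords-complete n w |w|<n)))

single : Word → Valuation 1 0
single w = just w ∷ [] , []

pair : Maybe Word → Maybe Word → Valuation 2 0
pair m m′ = m ∷ m′ ∷ [] , []

off-path-strip : ∀ b w m → (∀ r → m ≢ just (b ∷ w ++ r)) → ∀ r → (m >>= strip b) ≢ just (w ++ r)
off-path-strip b w nothing  off r ()
off-path-strip b w (just u) off r stripped = off r (cong just (strip-just b u stripped))

-- The first variable lies off the path w, so only the subtree below w sees the second one change.
state-replace : (A : Automaton 2 0) → ∀ w m {s s′} → (∀ r → m ≢ just (w ++ r)) →
                state A (pair nothing (just s)) ≡ state A (pair nothing (just s′)) →
                state A (pair m (just (w ++ s))) ≡ state A (pair m (just (w ++ s′)))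
state-replace A []      nothing  off same = same
state-replace A []      (just u) off same = ⊥-elim (off u refl)
state-replace A (false ∷ w) m {s} {s′} off same = begin
  state A (pair m (just (false ∷ w ++ s)))                                  ≡⟨ state-unfold A _ ⟩
  step A (atRoot m ∷ false ∷ [] , []) (state A (pair (m >>= strip false) (just (w ++ s))))
                                      (state A (pair (m >>= strip true) nothing))
    ≡⟨ cong (λ q → step A (atRoot m ∷ false ∷ [] , []) q (state A (pair (m >>= strip true) nothing)))
            (state-replace A w (m >>= strip false) (off-path-strip false w m off) same) ⟩
  step A (atRoot m ∷ false ∷ [] , []) (state A (pair (m >>= strip false) (just (w ++ s′))))
                                      (state A (pair (m >>= strip true) nothing))
    ≡⟨ state-unfold A _ ⟨
  state A (pair m (just (false ∷ w ++ s′)))                                 ∎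
  where open ≡-Reasoning
state-replace A (true ∷ w) m {s} {s′} off same = begin
  state A (pair m (just (true ∷ w ++ s)))                                   ≡⟨ state-unfold A _ ⟩
  step A (atRoot m ∷ false ∷ [] , []) (state A (pair (m >>= strip false) nothing))
                                      (state A (pair (m >>= strip true) (just (w ++ s))))
    ≡⟨ cong (step A (atRoot m ∷ false ∷ [] , []) (state A (pair (m >>= strip false) nothing)))
            (state-replace A w (m >>= strip true) (off-path-strip true w m off) same) ⟩
  step A (atRoot m ∷ false ∷ [] , []) (state A (pair (m >>= strip false) nothing))
                                      (state A (pair (m >>= strip true) (just (w ++ s′))))
    ≡⟨ state-unfold A _ ⟨
  state A (pair m (just (true ∷ w ++ s′)))                                  ∎
  where open ≡-Reasoning

EventuallyPeriodic : (ℕ → Word) → Set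
EventuallyPeriodic f = ∃ λ a₀ → ∃ λ n → 0 < n × ∃₂ λ x y → Σ (ℕ → Word) λ T →
  (∀ k → f (a₀ + k) ≡ x ++ T k) × (∀ k → T (n + k) ≡ y ++ T k)

module Isomorphism (I : Interpretation) (f : ℕ → Word) (iso : IsIsoFromΔ₁ I f) where

  private
    f-injective : ∀ a b → f a ≡ f b → a ≡ b
    f-injective = proj₁ iso

    f-Dom : ∀ a → Dom I (f a)
    f-Dom = proj₁ (proj₂ iso)

    f-onto : ∀ u → Dom I u → ∃ λ a → f a ≡ u
    f-onto = proj₁ (proj₂ (proj₂ iso))

    f-Rel : ∀ a b → Rel I (f a) (f b) ⇔ (b ≡ suc a)
    f-Rel = proj₂ (proj₂ (proj₂ iso))

    Rδ : Recognizer 1 0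
    Rδ = compile (Interpretation.δ I)

    RΦ : Recognizer 2 0
    RΦ = compile (Interpretation.Φ I)

    Aδ : Automaton 1 0
    Aδ = automaton Rδ

    AΦ : Automaton 2 0
    AΦ = automaton RΦ

  Dom⇔ : ∀ w → Dom I w ⇔ Accepts Rδ (single w)
  Dom⇔ w = compile-correct (Interpretation.δ I) (one w) noSets

  Rel⇔ : ∀ u w → Rel I u w ⇔ Accepts RΦ (pair (just u) (just w))
  Rel⇔ u w = compile-correct (Interpretation.Φ I) (two u w) noSets

  Dom? : Decidable (Dom I)
  Dom? w = map′ (Equivalence.from (Dom⇔ w)) (Equivalence.to (Dom⇔ w)) (accept? Rδ _)

  Profile : Finite
  Profile = States AΦ ×ᶠ States Aδ

  profile : Word → Carrier Profile
  profile s = state AΦ (pair nothing (just s)) , state Aδ (single s)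

  actᴾ : Word → Carrier Profile → Carrier Profile
  actᴾ z (p , q) = act AΦ z p , act Aδ z q

  profile-++ : ∀ x s → profile (x ++ s) ≡ actᴾ x (profile s)
  profile-++ x s = cong₂ _,_ (state-prefix-words AΦ x (nothing ∷ just s ∷ [])) (state-prefix-words Aδ x (just s ∷ []))

  Dom-transfer : ∀ {x x′} → (∀ q → actᴾ x q ≡ actᴾ x′ q) → ∀ w → Dom I (x ++ w) → Dom I (x′ ++ w)
  Dom-transfer {x} {x′} same w dom = Equivalence.from (Dom⇔ (x′ ++ w))
    (subst (Accept Rδ) same-state (Equivalence.to (Dom⇔ (x ++ w)) dom))
    where
    same-state : state Aδ (single (x ++ w)) ≡ state Aδ (single (x′ ++ w))
    same-state = trans (state-prefix-words Aδ x (just w ∷ [])) (trans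
      (cong proj₂ (same (idle AΦ , state Aδ (single w))))
      (sym (state-prefix-words Aδ x′ (just w ∷ []))))

  Rel-transfer : ∀ {x x′} → (∀ q → actᴾ x q ≡ actᴾ x′ q) → ∀ w w′ → Rel I (x ++ w) (x ++ w′) → Rel I (x′ ++ w) (x′ ++ w′)
  Rel-transfer {x} {x′} same w w′ rel = Equivalence.from (Rel⇔ (x′ ++ w) (x′ ++ w′))
    (subst (Accept RΦ) same-state (Equivalence.to (Rel⇔ (x ++ w) (x ++ w′)) rel))
    where
    ws : Vec (Maybe Word) 2
    ws = just w ∷ just w′ ∷ []

    same-state : state AΦ (pair (just (x ++ w)) (just (x ++ w′))) ≡ state AΦ (pair (just (x′ ++ w)) (just (x′ ++ w′)))
    same-state = trans (state-prefix-words AΦ x ws) (trans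
      (cong proj₁ (same (state AΦ (ws , []) , idle Aδ)))
      (sym (state-prefix-words AΦ x′ ws)))

  successor-near : ∀ a w s → f (suc a) ≡ w ++ s → size Profile ≤ length s → ∃ λ r → w ++ r ≡ f a
  successor-near a w s f[1+a]≡ size≤ with w ⊑? f a
  ... | yes w⊑fa = w⊑fa
  ... | no  w⋢fa with s′ , shorter , same ← pump-down Profile profile actᴾ profile-++ s size≤
    = ⊥-elim (ℕ.<-irrefl (cong length s′≡s) shorter)
    where
    off : ∀ r → just (f a) ≢ just (w ++ r)
    off r fa≡ = w⋢fa (r , sym (just-injective fa≡))

    rel : Rel I (f a) (w ++ s′)
    rel = Equivalence.from (Rel⇔ (f a) (w ++ s′)) (subst (Accept RΦ)
      (state-replace AΦ w (just (f a)) off (cong proj₁ (sym same)))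
      (subst (λ u → Accepts RΦ (pair (just (f a)) (just u))) f[1+a]≡
        (Equivalence.to (Rel⇔ (f a) (f (suc a))) (Equivalence.from (f-Rel a (suc a)) refl))))

    dom : Dom I (w ++ s′)
    dom = Equivalence.from (Dom⇔ (w ++ s′)) (subst (Accept Rδ)
      (cong proj₂ (trans (profile-++ w s) (trans (cong (actᴾ w) (sym same)) (sym (profile-++ w s′)))))
      (subst (λ u → Accepts Rδ (single u)) f[1+a]≡ (Equivalence.to (Dom⇔ (f (suc a))) (f-Dom (suc a)))))

    s′≡s : s′ ≡ s
    s′≡s with b , fb≡ ← f-onto (w ++ s′) dom with refl ← Equivalence.to (f-Rel a b) (subst (Rel I (f a)) (sym fb≡) rel)
      = List.++-cancelˡ w s′ s (trans (sym fb≡) f[1+a]≡)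

  preimage-bound : ∀ ws → ∃ λ a₀ → ∀ b → f b ∈ ws → b < a₀
  preimage-bound []       = 0 , λ _ ()
  preimage-bound (w ∷ ws) with a₀ , bound ← preimage-bound ws | Dom? w
  ... | no ¬dom = a₀ , λ where
    b (here refl) → ⊥-elim (¬dom (f-Dom b))
    b (there fb∈) → bound b fb∈
  ... | yes dom with c , fc≡w ← f-onto w dom = suc c ℕ.⊔ a₀ , λ where
    b (here fb≡w) → ℕ.≤-trans (s≤s (ℕ.≤-reflexive (f-injective b c (trans fb≡w (sym fc≡w))))) (ℕ.m≤m⊔n (suc c) a₀)
    b (there fb∈) → ℕ.≤-trans (bound b fb∈) (ℕ.m≤n⊔m (suc c) a₀)

  eventually-long : ∀ L → ∃ λ a₀ → ∀ k → L ≤ length (f (a₀ + k))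
  eventually-long L with a₀ , bound ← preimage-bound (shortWords L) = a₀ , long
    where
    long : ∀ k → L ≤ length (f (a₀ + k))
    long k with L ℕ.≤? length (f (a₀ + k))
    ... | yes L≤ = L≤
    ... | no  L≰ = ⊥-elim (ℕ.<⇒≱ (bound _ (shortWords-complete L _ (ℕ.≰⇒> L≰))) (ℕ.m≤m+n a₀ k))

  stable-prefix : ∀ N → ∃ λ a₀ → N ≤ length (f a₀) × ∀ k → List.take N (f (a₀ + k)) ≡ List.take N (f a₀)
  stable-prefix N with a₀ , long ← eventually-long (size Profile + N) =
    a₀ , subst (λ a → N ≤ length (f a)) (ℕ.+-identityʳ a₀) (ℕ.m+n≤o⇒n≤o (size Profile) (long 0)) , stable
    where
    next : ∀ k → List.take N (f (a₀ + suc k)) ≡ List.take N (f (a₀ + k))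
    next k = sym (trans (cong (List.take N) (sym (proj₂ near)))
                        (take-++ (List.take N y) (proj₁ near) (trans (List.length-take N y) (ℕ.m≤n⇒m⊓n≡m N≤|y|))))
      where
      y : Word
      y = f (a₀ + suc k)

      N≤|y| : N ≤ length y
      N≤|y| = ℕ.m+n≤o⇒n≤o (size Profile) (long (suc k))

      near : ∃ λ r → List.take N y ++ r ≡ f (a₀ + k)
      near = successor-near (a₀ + k) (List.take N y) (List.drop N y)
        (trans (cong f (sym (ℕ.+-suc a₀ k))) (sym (List.take++drop≡id N y)))
        (subst (size Profile ≤_) (sym (List.length-drop N y)) (ℕ.m+n≤o⇒m≤o∸n (size Profile) (long (suc k))))

    stable : ∀ k → List.take N (f (a₀ + k)) ≡ List.take N (f a₀)
    stable zero    = cong (λ a → List.take N (f a)) (ℕ.+-identityʳ a₀)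
    stable (suc k) = trans (next k) (stable k)

  -- Opaque for the same reason as `state`.
  opaque
    Codes : Finite
    Codes = Vecᶠ Profile (size Profile)

    code : Word → Carrier Codes
    code x = Finite.tabulate Profile (actᴾ x)

    code-injective : ∀ {x x′} → code x ≡ code x′ → ∀ q → actᴾ x q ≡ actᴾ x′ q
    code-injective = Finite.tabulate-injective Profile

  pumpable-prefix : ∃ λ a₀ → ∃₂ λ x y → Σ (ℕ → Word) λ T →
    0 < length y × (∀ q → actᴾ x q ≡ actᴾ (x ++ y) q) × (∀ k → f (a₀ + k) ≡ x ++ T k)
  pumpable-prefix
    with a₀ , N≤ , stable ← stable-prefix (size Codes)
    with x , y , z , g≡ , 0<|y| , same-code ←
           loop-decomposition Codes (λ x _ → code x) (List.take (size Codes) (f a₀))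
             (ℕ.≤-reflexive (sym (trans (List.length-take (size Codes) (f a₀)) (ℕ.m≤n⇒m⊓n≡m N≤))))
    = a₀ , x , y , (λ k → (y ++ z) ++ List.drop (size Codes) (f (a₀ + k))) , 0<|y| ,
      code-injective same-code , split
    where
    split : ∀ k → f (a₀ + k) ≡ x ++ (y ++ z) ++ List.drop (size Codes) (f (a₀ + k))
    split k = begin
      f (a₀ + k)
        ≡⟨ List.take++drop≡id (size Codes) (f (a₀ + k)) ⟨
      List.take (size Codes) (f (a₀ + k)) ++ List.drop (size Codes) (f (a₀ + k))
        ≡⟨ cong (_++ List.drop (size Codes) (f (a₀ + k))) (trans (stable k) g≡) ⟩
      (x ++ y ++ z) ++ List.drop (size Codes) (f (a₀ + k))
        ≡⟨ List.++-assoc x (y ++ z) _ ⟩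
      x ++ (y ++ z) ++ List.drop (size Codes) (f (a₀ + k)) ∎
      where open ≡-Reasoning

  shifted-copy : ∀ {a₀ x x′} {T : ℕ → Word} → (∀ q → actᴾ x q ≡ actᴾ x′ q) → (∀ k → f (a₀ + k) ≡ x ++ T k) →
                 ∃ λ h₀ → ∀ k → f (h₀ + k) ≡ x′ ++ T k
  shifted-copy {a₀} {x} {x′} {T} same split = h 0 , λ k → trans (cong f (h-linear k)) (h-copy k)
    where
    preimage : ∀ k → ∃ λ b → f b ≡ x′ ++ T k
    preimage k = f-onto (x′ ++ T k) (Dom-transfer same (T k) (subst (Dom I) (split k) (f-Dom (a₀ + k))))

    h : ℕ → ℕ
    h k = proj₁ (preimage k)

    h-copy : ∀ k → f (h k) ≡ x′ ++ T k
    h-copy k = proj₂ (preimage k)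

    h-suc : ∀ k → h (suc k) ≡ suc (h k)
    h-suc k = Equivalence.to (f-Rel (h k) (h (suc k))) (subst₂ (Rel I) (sym (h-copy k)) (sym (h-copy (suc k)))
      (Rel-transfer same (T k) (T (suc k)) (subst₂ (Rel I) (split k) (split (suc k))
        (Equivalence.from (f-Rel (a₀ + k) (a₀ + suc k)) (ℕ.+-suc a₀ k)))))

    h-linear : ∀ k → h 0 + k ≡ h k
    h-linear zero    = ℕ.+-identityʳ (h 0)
    h-linear (suc k) = trans (ℕ.+-suc (h 0) k) (trans (cong suc (h-linear k)) (sym (h-suc k)))

  eventually-periodic : EventuallyPeriodic f
  eventually-periodic
    with a₀ , x , y , T , 0<|y| , same , split ← pumpable-prefix
    with h₀ , copy ← shifted-copy {a₀} {x} {x ++ y} {T} same split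
    = a₀ , n , ℕ.m<n⇒0<n∸m a₀<h₀ , x , y , T , split , period
    where
    longer : ∀ k → length (f (a₀ + k)) < length (f (h₀ + k))
    longer k = subst₂ _<_ (sym (cong length (split k))) (sym (cong length (copy k)))
      (subst₂ _<_ (sym (List.length-++ x)) (sym (trans (List.length-++ (x ++ y)) (cong (_+ length (T k)) (List.length-++ x))))
        (ℕ.+-monoˡ-< (length (T k)) (ℕ.m<m+n (length x) 0<|y|)))

    a₀<h₀ : a₀ < h₀
    a₀<h₀ = shifted-longer⇒< (length ∘ f) longer

    n : ℕ
    n = h₀ ∸ a₀

    period : ∀ k → T (n + k) ≡ y ++ T k
    period k = List.++-cancelˡ x _ _ (begin
      x ++ T (n + k)        ≡⟨ split (n + k) ⟨
      f (a₀ + (n + k))    ≡⟨ cong f (trans (sym (ℕ.+-assoc a₀ n k)) (cong (_+ k) (ℕ.m+[n∸m]≡n (ℕ.<⇒≤ a₀<h₀)))) ⟩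
      f (h₀ + k)            ≡⟨ copy k ⟩
      (x ++ y) ++ T k         ≡⟨ List.++-assoc x y (T k) ⟩
      x ++ y ++ T k           ∎)
      where open ≡-Reasoning

eventually-periodic⇒ultimately-periodic : ∀ {f} → EventuallyPeriodic f →
  Σ ℕ λ m → Σ ℕ λ n → 0 < m × 0 < n × Σ Word λ u → Σ Word λ v → Σ (Fin n → Word) λ w →
  ((k : ℕ) (p : Fin n) → f (m + k * n + toℕ p) ≡ u ++ (v ^^ k) ++ w p)
eventually-periodic⇒ultimately-periodic {f} (a₀ , n , 0<n , x , y , T , split , shift) =
  a₀ + n , n , ℕ.<-≤-trans 0<n (ℕ.m≤n+m n a₀) , 0<n , x ++ y , y , T ∘ toℕ , periodic
  where
  periodic : ∀ k p → f (a₀ + n + k * n + toℕ p) ≡ (x ++ y) ++ (y ^^ k) ++ T (toℕ p)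
  periodic k p = begin
    f (a₀ + n + k * n + toℕ p)        ≡⟨ cong f (trans (ℕ.+-assoc (a₀ + n) (k * n) (toℕ p)) (ℕ.+-assoc a₀ n _)) ⟩
    f (a₀ + (n + (k * n + toℕ p)))    ≡⟨ split _ ⟩
    x ++ T (n + (k * n + toℕ p))      ≡⟨ cong (x ++_) (shift _) ⟩
    x ++ y ++ T (k * n + toℕ p)       ≡⟨ cong (λ t → x ++ y ++ t) (iterate-shift y shift k (toℕ p)) ⟩
    x ++ y ++ (y ^^ k) ++ T (toℕ p)   ≡⟨ List.++-assoc x y _ ⟨
    (x ++ y) ++ (y ^^ k) ++ T (toℕ p) ∎
    where open ≡-Reasoning

lemma5p8 : (I : Interpretation) (f : ℕ → Word) → IsIsoFromΔ₁ I f →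
    Σ ℕ λ m → Σ ℕ λ n → 0 < m × 0 < n × Σ Word λ u → Σ Word λ v → Σ (Fin n → Word) λ w →
    ((k : ℕ) (p : Fin n) → f (m + k * n + toℕ p) ≡ u ++ (v ^^ k) ++ w p)
lemma5p8 I f iso = eventually-periodic⇒ultimately-periodic {f} (Isomorphism.eventually-periodic I f iso)
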